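{- Let $q=p^e$ be a prime power with $p$ prime, let $h,k$ be integers with $3\le h\le k$, and let $$D_2=\Bigl\{(x_1,\dots,x_k)\in\mathbb{F}_q^k\setminus\{0\}:\prod_{1\le i<j\le h}(x_i+x_j)=0\Bigr\}.$$ Then the length $\#D_2$ of the code $\mathrm{C}_{D_2}$ equals $$\begin{cases}q^{k-h}\bigl(q^h-q(q-1)\cdots(q-h+1)\bigr)-1,& p=2,\ h\le q;\\ q^k-1,& p=2,\ h>q;\\ q^{k-h}\bigl(q^h-\Gamma(h,q)-h\,\Gamma(h-1,q)\bigr)-1,& p>2,\end{cases}$$ where $$\Gamma(m,q)=\sum_{s=1}^{\min(m,(q-1)/2)}\frac{(q-1)(q-3)\cdots(q-2s+1)}{s!}\,\mathcal{S}(m,s).$$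
   Context: $\mathcal{S}(x,y)$ denotes the number of surjective functions from a set of size $x$ onto a set of size $y\le x$. For a finite list $D$ of points of $\mathbb{F}_q^k$, $\mathrm{C}_D$ is the code $\{(a\cdot P)_{P\in D}:a\in\mathbb{F}_q^k\}$, whose length is $\#D$. -}

module Defs where

open import Level using (0ℓ)
open import Algebra.Bundles using (CommutativeRing)
open import Function.Bundles using (Inverse)
open import Function using (_∘_)
open import Relation.Binary.Bundles using (Setoid)
open import Relation.Binary.Definitions using (Decidable)
import Relation.Binary.PropositionalEquality as ≡
open import Relation.Nullary using (¬_; Dec; yes; no)
open import Relation.Nullary.Decidable using (_×-dec_; ¬?)
open import Data.Nat using (ℕ; zero; suc; _∸_; _≤_; _⊓_)
open import Data.Nat.Combinatorics using ()
open import Data.Nat.Properties using (_!≢0)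
import Data.Nat as ℕ
open import Data.Nat.DivMod using (_/_)
open import Data.Fin using (Fin; inject≤) renaming (zero to fz; suc to fs)
import Data.Fin as Fin
open import Data.Fin.Properties using (any?; all?)
open import Data.List using (List; []; _∷_; map; concatMap; filter; length; allFin)
open import Data.Product using (_×_; ∃; _,_)
open import Data.Integer using (+_)
open import Data.Rational using (ℚ) renaming (_+_ to _+ℚ_; _*_ to _*ℚ_)
import Data.Rational as ℚ

record FiniteField : Set₁ where
  field
    commRing : CommutativeRing 0ℓ 0ℓ
  open CommutativeRing commRing public
  field
    0≉1     : ¬ (0# ≈ 1#)
    inverse : ∀ x → ¬ (x ≈ 0#) → ∃ λ y → x * y ≈ 1#
    _≟_     : Decidable _≈_
    size    : ℕ
    enum    : Inverse (≡.setoid (Fin size)) setoid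

allFunctions : ∀ {A : Set} → List A → (n : ℕ) → List (Fin n → A)
allFunctions xs zero    = (λ ()) ∷ []
allFunctions xs (suc n) =
  concatMap (λ a → map (λ f → λ { fz → a ; (fs i) → f i }) (allFunctions xs n)) xs

Surjective? : ∀ {x y} (f : Fin x → Fin y) → Dec (∀ b → ∃ λ a → f a ≡.≡ b)
Surjective? f = all? (λ b → any? (λ a → f a Fin.≟ b))

𝒮 : ℕ → ℕ → ℕ
𝒮 x y = length (filter Surjective? (allFunctions (allFin y) x))

module _ (F : FiniteField) where
  open FiniteField F

  elements : List Carrier
  elements = map (Inverse.to enum) (allFin size)

  prodFin : (n : ℕ) → (Fin n → Carrier) → Carrier
  prodFin zero    f = 1#
  prodFin (suc n) f = f fz * prodFin n (f ∘ fs)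

  pairProd : (n : ℕ) → (Fin n → Carrier) → Carrier
  pairProd zero    x = 1#
  pairProd (suc n) x = prodFin n (λ j → x fz + x (fs j)) * pairProd n (x ∘ fs)

  -- membership in D₂ ⊆ F_q^k for 1 ≤ h ≤ k (coordinates indexed by Fin k;
  -- the first h coordinates are x₁,…,x_h)
  InD₂ : (h k : ℕ) → h ≤ k → (Fin k → Carrier) → Set
  InD₂ h k h≤k x = ¬ (∀ i → x i ≈ 0#) × (pairProd h (λ i → x (inject≤ i h≤k)) ≈ 0#)

  InD₂? : (h k : ℕ) (h≤k : h ≤ k) (x : Fin k → Carrier) → Dec (InD₂ h k h≤k x)
  InD₂? h k h≤k x = ¬? (all? (λ i → x i ≟ 0#)) ×-dec (pairProd h (λ i → x (inject≤ i h≤k)) ≟ 0#)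

  cardD₂ : (h k : ℕ) → h ≤ k → ℕ
  cardD₂ h k h≤k = length (filter (InD₂? h k h≤k) (allFunctions elements k))

falling : ℕ → ℕ → ℕ
falling q zero    = 1
falling q (suc h) = falling q h ℕ.* (q ∸ h)

oddFalling : ℕ → ℕ → ℕ
oddFalling q zero    = 1
oddFalling q (suc s) = oddFalling q s ℕ.* (q ∸ (2 ℕ.* s ℕ.+ 1))

ℕ→ℚ : ℕ → ℚ
ℕ→ℚ n = + n ℚ./ 1

sum1 : ℕ → (ℕ → ℚ) → ℚ
sum1 zero    f = ℚ.0ℚ
sum1 (suc n) f = sum1 n f +ℚ f (suc n)

Γ : ℕ → ℕ → ℚ
Γ m q = sum1 (m ⊓ ((q ∸ 1) / 2))
  (λ s → ((+ oddFalling q s) ℚ./ (s ℕ.!)) {{s !≢0}} *ℚ ℕ→ℚ (𝒮 m s))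

module Submission where

-- #D₂ + 1 counts the x ∈ F_q^k with x_i + x_j = 0 for some 1 ≤ i < j ≤ h
-- (the zero vector is one of them), so #D₂ + 1 = (q^h - A_h) q^(k-h), where
-- A_h counts the "admissible" h-tuples, in which no two entries add up to 0.
-- All cardinalities are rewritten as iterated sums of indicators over
-- tuples (the bridge lemma count-allFunctions), and A_h is computed by
-- adding one entry at a time: a new first entry a is allowed iff - a is not
-- a value of the tuple.  The characteristic is read off the parity of q,
-- obtained by pairing field elements along a fixed-point-free involution.
--  * Characteristic 2 (q = 2^e): - a = a, admissible means distinct entries,
--    so A_h = q(q-1)⋯(q-h+1), which vanishes for h > q.
--  * Odd characteristic (q = p^e, p > 2): only 0 can occur together with
--    its negative.  Counting admissible tuples by whether they contain 0 and
--    by their number t of nonzero values gives recurrences which, with the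
--    recurrence 𝒮(m+1,t+1) = (t+1)(𝒮(m,t+1) + 𝒮(m,t)) proved first, yield
--    N(m,t) t! = (q-1)(q-3)⋯(q-2t+1) 𝒮(m,t) for the zero-free ones, and
--    m N(m-1,t) for those containing 0; summing over t gives
--    A_h = Γ(h,q) + h Γ(h-1,q).

module Counting where

  open import Data.Bool using (Bool; true; false; if_then_else_; _∨_)
  import Data.Bool as Bool
  open import Data.Empty using (⊥; ⊥-elim)
  open import Data.Unit using (⊤; tt)
  open import Data.Product using (_×_; _,_; ∃)
  open import Data.Sum using (_⊎_; inj₁; inj₂)
  open import Data.Nat using (ℕ; zero; suc; _+_; _*_; _∸_; _^_; _≤_; _<_; _⊓_; _!; z≤n; s≤s)
  import Data.Nat as ℕ
  open import Data.Nat.Tactic.RingSolver using (solve-∀)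
  open import Data.Nat.DivMod using (_/_; m*n/n≡m)
  open import Data.Nat.Divisibility using (_∣_; divides; ∣1⇒≡1)
  open import Data.Nat.Primality using (Prime; euclidsLemma; prime[2]; prime⇒irreducible)
  import Data.Nat.Properties as ℕP
  open import Data.Nat.Properties using (_!≢0)
  open import Data.Fin using (Fin; zero; suc; toℕ; inject≤; punchIn)
  import Data.Fin as Fin
  open import Data.Fin.Properties using (punchInᵢ≢i; all?; any?; toℕ-injective; toℕ<n)
  open import Data.Fin.Permutation using (Permutation; permutation; _⟨$⟩ʳ_)
  open import Function.Bundles using (Inverse)
  open import Data.Vec.Functional using () renaming (_∷_ to _◃_)
  open import Data.List using (List; []; _∷_; [_]; _++_; map; concatMap; filter; length; tabulate)
  import Data.List.Properties as ListP
  open import Function using (_∘_)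
  open import Relation.Nullary using (¬_; Dec; yes; no; does)
  open import Relation.Nullary.Decidable using (_×-dec_; _⊎-dec_; _→-dec_; ¬?)
  open import Relation.Binary.PropositionalEquality
    using (_≡_; _≢_; _≗_; refl; sym; trans; cong; cong₂; subst; subst₂; module ≡-Reasoning)
  import Relation.Binary.Reasoning.Setoid
  open import Algebra.Properties.Semiring.Sum ℕP.+-*-semiring
    using (sum; sum-syntax; sum-cong-≗; ∑-distrib-+; ∑-comm; ∑-permute; *-distribˡ-sum; *-distribʳ-sum; sum-remove; sum-replicate-zero)

  import Data.Integer as ℤ
  import Data.Integer.Properties as ℤP
  open import Data.Rational using (ℚ)
  import Data.Rational as ℚ
  import Data.Rational.Properties as ℚP
  open import Data.Rational.Unnormalised using (mkℚᵘ; *≡*)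
  import Data.Rational.Unnormalised as ℚᵘ
  import Data.Rational.Unnormalised.Properties as ℚᵘP
  open import Data.Rational.Solver using () renaming (module +-*-Solver to ℚSolver)

  open import Defs

  χ : ∀ {p} {P : Set p} → Dec P → ℕ
  χ (yes _) = 1
  χ (no _)  = 0

  module _ {p q} {P : Set p} {Q : Set q} where

    χ-cong : (d : Dec P) (d′ : Dec Q) → (P → Q) → (Q → P) → χ d ≡ χ d′
    χ-cong (yes _) (yes _) _ _ = refl
    χ-cong (yes p) (no ¬q) f _ = ⊥-elim (¬q (f p))
    χ-cong (no ¬p) (yes q) _ g = ⊥-elim (¬p (g q))
    χ-cong (no _)  (no _)  _ _ = refl

    χ-× : (d : Dec P) (d′ : Dec Q) → χ (d ×-dec d′) ≡ χ d * χ d′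
    χ-× (yes _) (yes _) = refl
    χ-× (yes _) (no _)  = refl
    χ-× (no _)  _       = refl

    χ-⊎ : (d : Dec P) (d′ : Dec Q) → χ (d ⊎-dec d′) ≡ χ d′ + χ d * χ (¬? d′)
    χ-⊎ (yes _) (yes _) = refl
    χ-⊎ (yes _) (no _)  = refl
    χ-⊎ (no _)  (yes _) = refl
    χ-⊎ (no _)  (no _)  = refl

  module _ {p} {P : Set p} where

    χ-yes : (d : Dec P) → P → χ d ≡ 1
    χ-yes (yes _) _  = refl
    χ-yes (no ¬p) p = ⊥-elim (¬p p)

    χ-no : (d : Dec P) → ¬ P → χ d ≡ 0
    χ-no (yes p) ¬p = ⊥-elim (¬p p)
    χ-no (no _)  _  = refl

    χ-¬ : (d : Dec P) → χ (¬? d) + χ d ≡ 1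
    χ-¬ (yes _) = refl
    χ-¬ (no _)  = refl

    χ-¬×+ : ∀ {q} {Q : Set q} (d : Dec P) (d′ : Dec Q) → (P → Q) → χ (¬? d ×-dec d′) + χ d ≡ χ d′
    χ-¬×+ (yes p) (yes _) _   = refl
    χ-¬×+ (yes p) (no ¬q) p⇒q = ⊥-elim (¬q (p⇒q p))
    χ-¬×+ (no _)  (yes _) _   = refl
    χ-¬×+ (no _)  (no _)  _   = refl

    χ-idem : (d : Dec P) → χ d * χ d ≡ χ d
    χ-idem (yes _) = refl
    χ-idem (no _)  = refl

    χ≤1 : (d : Dec P) → χ d ≤ 1
    χ≤1 (yes _) = s≤s z≤n
    χ≤1 (no _)  = z≤n

    χ-guard : (d : Dec P) {x y : ℕ} → (P → x ≡ y) → χ d * x ≡ χ d * y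
    χ-guard (yes p) eq = cong (_+ 0) (eq p)
    χ-guard (no _)  _  = refl

  ∑-cong : ∀ n {f g : Fin n → ℕ} → (∀ i → f i ≡ g i) → ∑[ i < n ] f i ≡ ∑[ i < n ] g i
  ∑-cong n = sum-cong-≗

  ∑-const : ∀ n c → ∑[ i < n ] c ≡ n * c
  ∑-const zero    c = refl
  ∑-const (suc n) c = cong (c +_) (∑-const n c)

  ∑-single : ∀ {n} (t : Fin n → ℕ) i → (∀ j → j ≢ i → t j ≡ 0) → sum t ≡ t i
  ∑-single {suc n} t i vanish = begin
    sum t                                   ≡⟨ sum-remove {i = i} t ⟩
    t i + ∑[ j < n ] t (punchIn i j)        ≡⟨ cong (t i +_) (∑-cong n (λ j → vanish _ (punchInᵢ≢i i j))) ⟩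
    t i + ∑[ j < n ] 0                      ≡⟨ cong (t i +_) (sum-replicate-zero n) ⟩
    t i + 0                                 ≡⟨ ℕP.+-identityʳ (t i) ⟩
    t i                                     ∎
    where open ≡-Reasoning

  ∑-pick : ∀ {n} (g : Fin n → ℕ) b → ∑[ c < n ] (χ (c Fin.≟ b) * g c) ≡ g b
  ∑-pick {n} g b = begin
    ∑[ c < n ] (χ (c Fin.≟ b) * g c)  ≡⟨ ∑-single {n} (λ c → χ (c Fin.≟ b) * g c) b vanish ⟩
    χ (b Fin.≟ b) * g b               ≡⟨ cong (_* g b) (χ-yes (b Fin.≟ b) refl) ⟩
    1 * g b                           ≡⟨ ℕP.*-identityˡ (g b) ⟩
    g b                               ∎
    where
    open ≡-Reasoning
    vanish : ∀ c → c ≢ b → χ (c Fin.≟ b) * g c ≡ 0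
    vanish c c≢b = cong (_* g c) (χ-no (c Fin.≟ b) c≢b)

  ∑-linear : ∀ n (c d : Fin n → ℕ) x y → ∑[ i < n ] (c i * x + d i * y) ≡ sum c * x + sum d * y
  ∑-linear n c d x y = begin
    ∑[ i < n ] (c i * x + d i * y)              ≡⟨ ∑-distrib-+ (λ i → c i * x) (λ i → d i * y) ⟩
    ∑[ i < n ] (c i * x) + ∑[ i < n ] (d i * y) ≡⟨ cong₂ _+_ (*-distribʳ-sum x c) (*-distribʳ-sum y d) ⟨
    sum c * x + sum d * y                       ∎
    where open ≡-Reasoning

  ∑₁ : ℕ → (ℕ → ℕ) → ℕ
  ∑₁ zero    g = 0
  ∑₁ (suc n) g = ∑₁ n g + g (suc n)

  ∑₁-cong : ∀ n {g h : ℕ → ℕ} → (∀ t → g t ≡ h t) → ∑₁ n g ≡ ∑₁ n h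
  ∑₁-cong zero    eq = refl
  ∑₁-cong (suc n) eq = cong₂ _+_ (∑₁-cong n eq) (eq (suc n))

  ∑₁-*ˡ : ∀ n c (g : ℕ → ℕ) → c * ∑₁ n g ≡ ∑₁ n (λ t → c * g t)
  ∑₁-*ˡ zero    c g = ℕP.*-zeroʳ c
  ∑₁-*ˡ (suc n) c g = trans (ℕP.*-distribˡ-+ c (∑₁ n g) (g (suc n))) (cong (_+ c * g (suc n)) (∑₁-*ˡ n c g))

  ∑₁-vanish : ∀ n (g : ℕ → ℕ) → (∀ t → t ≤ n → g t ≡ 0) → ∑₁ n g ≡ 0
  ∑₁-vanish zero    g vanish = refl
  ∑₁-vanish (suc n) g vanish =
    cong₂ _+_ (∑₁-vanish n g (λ t t≤n → vanish t (ℕP.m≤n⇒m≤1+n t≤n))) (vanish (suc n) ℕP.≤-refl)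

  ∑₁-indicator : ∀ {s} n → s ≤ n → χ (s ℕ.≟ 0) + ∑₁ n (λ t → χ (s ℕ.≟ t)) ≡ 1
  ∑₁-indicator zero z≤n = refl
  ∑₁-indicator {s} (suc n) s≤1+n with s ℕ.≟ suc n
  ... | yes refl = cong (_+ 1) (∑₁-vanish n _ (λ t t≤n → χ-no (suc n ℕ.≟ t) (λ n+1≡t → ℕP.<⇒≱ (s≤s t≤n) (ℕP.≤-reflexive n+1≡t))))
  ... | no s≢1+n = trans (sym (ℕP.+-assoc (χ (s ℕ.≟ 0)) _ 0))
                         (trans (ℕP.+-identityʳ _) (∑₁-indicator n (ℕ.s≤s⁻¹ (ℕP.≤∧≢⇒< s≤1+n s≢1+n))))

  ∑₁-truncate : ∀ n X (g : ℕ → ℕ) → (∀ t → X < t → g t ≡ 0) → ∑₁ n g ≡ ∑₁ (n ⊓ X) g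
  ∑₁-truncate zero    X g vanish = refl
  ∑₁-truncate (suc n) X g vanish with suc n ℕ.≤? X
  ... | yes n<X = cong (λ m → ∑₁ m g) (sym (ℕP.m≤n⇒m⊓n≡m n<X))
  ... | no n≮X = begin
    ∑₁ n g + g (suc n)   ≡⟨ cong (∑₁ n g +_) (vanish (suc n) X<1+n) ⟩
    ∑₁ n g + 0           ≡⟨ ℕP.+-identityʳ _ ⟩
    ∑₁ n g               ≡⟨ ∑₁-truncate n X g vanish ⟩
    ∑₁ (n ⊓ X) g         ≡⟨ cong (λ m → ∑₁ m g) (trans (ℕP.m≥n⇒m⊓n≡n (ℕ.s≤s⁻¹ X<1+n)) (sym (ℕP.m≥n⇒m⊓n≡n (ℕP.<⇒≤ X<1+n)))) ⟩
    ∑₁ (suc n ⊓ X) g     ∎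
    where
    open ≡-Reasoning
    X<1+n : X < suc n
    X<1+n = ℕP.≰⇒> n≮X

  module _ {A : Set} {P : A → Set} (P? : ∀ x → Dec (P x)) where

    count-singleton : ∀ x → length (filter P? [ x ]) ≡ χ (P? x)
    count-singleton x with P? x
    ... | yes _ = refl
    ... | no _  = refl

    count-++ : ∀ xs ys → length (filter P? (xs ++ ys)) ≡ length (filter P? xs) + length (filter P? ys)
    count-++ xs ys = trans (cong length (ListP.filter-++ P? xs ys)) (ListP.length-++ (filter P? xs))

    count-map : ∀ {B : Set} (g : B → A) xs → length (filter P? (map g xs)) ≡ length (filter (P? ∘ g) xs)
    count-map g []       = refl
    count-map g (x ∷ xs) with P? (g x)
    ... | yes _ = cong suc (count-map g xs)
    ... | no _  = count-map g xs

    count-concatMap : ∀ {B : Set} {r} (k : B → List A) (e : Fin r → B) →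
      length (filter P? (concatMap k (tabulate e))) ≡ ∑[ i < r ] length (filter P? (k (e i)))
    count-concatMap {r = zero}  k e = refl
    count-concatMap {r = suc r} k e =
      trans (count-++ (k (e zero)) _) (cong (length (filter P? (k (e zero))) +_) (count-concatMap k (e ∘ suc)))

  module TupleSum {A : Set} {r : ℕ} (e : Fin r → A) where

    ◃-cong : ∀ {n a} {f f′ : Fin n → A} → f ≗ f′ → (a ◃ f) ≗ (a ◃ f′)
    ◃-cong f≗f′ zero    = refl
    ◃-cong f≗f′ (suc i) = f≗f′ i

    ∑ᵗ : ∀ n → ((Fin n → A) → ℕ) → ℕ
    ∑ᵗ zero    g = g (λ ())
    ∑ᵗ (suc n) g = ∑[ i < r ] ∑ᵗ n (λ f → g (e i ◃ f))

    ∑ᵗ-cong : ∀ n {g g′ : (Fin n → A) → ℕ} → (∀ f → g f ≡ g′ f) → ∑ᵗ n g ≡ ∑ᵗ n g′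
    ∑ᵗ-cong zero    eq = eq _
    ∑ᵗ-cong (suc n) eq = ∑-cong r (λ i → ∑ᵗ-cong n (λ f → eq (e i ◃ f)))

    ∑ᵗ-distrib-+ : ∀ n (g g′ : (Fin n → A) → ℕ) → ∑ᵗ n (λ f → g f + g′ f) ≡ ∑ᵗ n g + ∑ᵗ n g′
    ∑ᵗ-distrib-+ zero    g g′ = refl
    ∑ᵗ-distrib-+ (suc n) g g′ = trans (∑-cong r (λ i → ∑ᵗ-distrib-+ n (λ f → g (e i ◃ f)) (λ f → g′ (e i ◃ f))))
      (∑-distrib-+ (λ i → ∑ᵗ n (λ f → g (e i ◃ f))) (λ i → ∑ᵗ n (λ f → g′ (e i ◃ f))))

    ∑ᵗ-*ˡ : ∀ n c (g : (Fin n → A) → ℕ) → c * ∑ᵗ n g ≡ ∑ᵗ n (λ f → c * g f)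
    ∑ᵗ-*ˡ zero    c g = refl
    ∑ᵗ-*ˡ (suc n) c g = trans (*-distribˡ-sum c (λ i → ∑ᵗ n (λ f → g (e i ◃ f)))) (∑-cong r (λ i → ∑ᵗ-*ˡ n c (λ f → g (e i ◃ f))))

    ∑ᵗ-const : ∀ n c → ∑ᵗ n (λ _ → c) ≡ r ^ n * c
    ∑ᵗ-const zero    c = sym (ℕP.+-identityʳ c)
    ∑ᵗ-const (suc n) c = begin
      ∑[ i < r ] ∑ᵗ n (λ _ → c) ≡⟨ ∑-cong r (λ _ → ∑ᵗ-const n c) ⟩
      ∑[ i < r ] (r ^ n * c)     ≡⟨ ∑-const r _ ⟩
      r * (r ^ n * c)            ≡⟨ ℕP.*-assoc r (r ^ n) c ⟨
      r ^ suc n * c              ∎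
      where open ≡-Reasoning

    ∑ᵗ-zero : ∀ n → ∑ᵗ n (λ _ → 0) ≡ 0
    ∑ᵗ-zero n = trans (∑ᵗ-const n 0) (ℕP.*-zeroʳ (r ^ n))

    ∑ᵗ-comm : ∀ n m (g : Fin m → (Fin n → A) → ℕ) → ∑ᵗ n (λ f → ∑[ j < m ] g j f) ≡ ∑[ j < m ] ∑ᵗ n (g j)
    ∑ᵗ-comm zero    m g = refl
    ∑ᵗ-comm (suc n) m g =
      trans (∑-cong r (λ i → ∑ᵗ-comm n m (λ j f → g j (e i ◃ f)))) (∑-comm (λ i j → ∑ᵗ n (λ f → g j (e i ◃ f))))

    ∑ᵗ-∑₁ : ∀ n B (g : ℕ → (Fin n → A) → ℕ) → ∑ᵗ n (λ f → ∑₁ B (λ t → g t f)) ≡ ∑₁ B (λ t → ∑ᵗ n (g t))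
    ∑ᵗ-∑₁ n zero    g = ∑ᵗ-zero n
    ∑ᵗ-∑₁ n (suc B) g = trans (∑ᵗ-distrib-+ n _ (g (suc B))) (cong (_+ ∑ᵗ n (g (suc B))) (∑ᵗ-∑₁ n B g))

    ∑ᵗ-prefix : ∀ {h k} (h≤k : h ≤ k) (g : (Fin h → A) → ℕ) → (∀ {f f′} → f ≗ f′ → g f ≡ g f′) →
      ∑ᵗ k (λ f → g (λ i → f (inject≤ i h≤k))) ≡ ∑ᵗ h g * r ^ (k ∸ h)
    ∑ᵗ-prefix {zero} {k} z≤n g g-resp = begin
      ∑ᵗ k (λ f → g (λ i → f (inject≤ i z≤n)))  ≡⟨ ∑ᵗ-cong k (λ _ → g-resp (λ ())) ⟩
      ∑ᵗ k (λ _ → g empty)                      ≡⟨ ∑ᵗ-const k _ ⟩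
      r ^ k * g empty                           ≡⟨ ℕP.*-comm (r ^ k) _ ⟩
      g empty * r ^ k                           ≡⟨ cong (_* r ^ k) (g-resp (λ ())) ⟩
      ∑ᵗ zero g * r ^ k                         ∎
      where
      open ≡-Reasoning
      empty : Fin zero → A
      empty ()
    ∑ᵗ-prefix {suc h} {suc k} (s≤s h≤k) g g-resp = begin
      ∑[ i < r ] ∑ᵗ k (λ f → g (λ j → (e i ◃ f) (inject≤ j (s≤s h≤k))))
        ≡⟨ ∑-cong r (λ i → ∑ᵗ-cong k (λ f → g-resp (prefix-cons (e i) f))) ⟩
      ∑[ i < r ] ∑ᵗ k (λ f → g (e i ◃ (λ j → f (inject≤ j h≤k))))
        ≡⟨ ∑-cong r (λ i → ∑ᵗ-prefix h≤k (λ f → g (e i ◃ f)) (λ f≗f′ → g-resp (◃-cong f≗f′))) ⟩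
      ∑[ i < r ] (∑ᵗ h (λ f → g (e i ◃ f)) * r ^ (k ∸ h))
        ≡⟨ ∑-cong r (λ i → ℕP.*-comm (∑ᵗ h (λ f → g (e i ◃ f))) _) ⟩
      ∑[ i < r ] (r ^ (k ∸ h) * ∑ᵗ h (λ f → g (e i ◃ f)))
        ≡⟨ *-distribˡ-sum (r ^ (k ∸ h)) (λ i → ∑ᵗ h (λ f → g (e i ◃ f))) ⟨
      r ^ (k ∸ h) * ∑ᵗ (suc h) g
        ≡⟨ ℕP.*-comm (r ^ (k ∸ h)) _ ⟩
      ∑ᵗ (suc h) g * r ^ (k ∸ h) ∎
      where
      open ≡-Reasoning
      prefix-cons : ∀ a (f : Fin k → A) → (λ j → (a ◃ f) (inject≤ j (s≤s h≤k))) ≗ (a ◃ (λ j → f (inject≤ j h≤k)))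
      prefix-cons a f zero    = refl
      prefix-cons a f (suc j) = refl

    count-allFunctions : ∀ n {P : (Fin n → A) → Set} (P? : ∀ f → Dec (P f)) →
      (∀ {f f′} → f ≗ f′ → P f → P f′) →
      length (filter P? (allFunctions (tabulate e) n)) ≡ ∑ᵗ n (λ f → χ (P? f))
    count-allFunctions zero P? P-resp =
      trans (count-singleton P? _) (χ-cong (P? _) (P? _) (P-resp (λ ())) (P-resp (λ ())))
    count-allFunctions (suc n) {P} P? P-resp = count-extensions _ (λ a f → λ { zero → refl ; (suc i) → refl })
      where
      count-extensions : (ext : A → (Fin n → A) → Fin (suc n) → A) → (∀ a f → ext a f ≗ (a ◃ f)) →
        length (filter P? (concatMap (λ a → map (ext a) (allFunctions (tabulate e) n)) (tabulate e)))
          ≡ ∑ᵗ (suc n) (λ f → χ (P? f))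
      count-extensions ext ext≗◃ = trans (count-concatMap P? _ e) (∑-cong r λ i →
        trans (count-map P? (ext (e i)) (allFunctions (tabulate e) n))
          (trans (count-allFunctions n (P? ∘ ext (e i)) (λ f≗f′ → P-resp (ext-cong f≗f′)))
            (∑ᵗ-cong n (λ f → χ-cong (P? _) (P? _) (P-resp (ext≗◃ (e i) f)) (P-resp (sym ∘ ext≗◃ (e i) f))))))
        where
        ext-cong : ∀ {a} {f f′ : Fin n → A} → f ≗ f′ → ext a f ≗ ext a f′
        ext-cong {a} {f} {f′} f≗f′ j = trans (ext≗◃ a f j) (trans (◃-cong f≗f′ j) (sym (ext≗◃ a f′ j)))

  -- coverNumber y m t counts the functions Fin m → Fin y whose image
  -- contains a given t-element subset T of Fin y: choosing the value b of
  -- the first entry leaves the subset T ∖ {b} to be covered, which has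
  -- t ∸ 1 elements for the t choices b ∈ T and t elements otherwise.
  -- Surjections are the coverings of the whole of Fin y.

  coverNumber : ℕ → ℕ → ℕ → ℕ
  coverNumber y zero    t = χ (t ℕ.≟ 0)
  coverNumber y (suc m) t = t * coverNumber y m (t ∸ 1) + (y ∸ t) * coverNumber y m t

  module Covering (y : ℕ) where
    open TupleSum {Fin y} (λ i → i)

    ∣_∣ : (Fin y → Bool) → ℕ
    ∣ T ∣ = ∑[ c < y ] χ (T c Bool.≟ true)

    Covers : (Fin y → Bool) → ∀ {m} → (Fin m → Fin y) → Set
    Covers T f = ∀ c → T c ≡ true → ∃ λ a → f a ≡ c

    Covers? : ∀ T {m} (f : Fin m → Fin y) → Dec (Covers T f)
    Covers? T f = all? (λ c → (T c Bool.≟ true) →-dec any? (λ a → f a Fin.≟ c))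

    _─_ : (Fin y → Bool) → Fin y → (Fin y → Bool)
    (T ─ b) c = if does (c Fin.≟ b) then false else T c

    covers-◃ : ∀ T b {m} (f : Fin m → Fin y) → Covers T (b ◃ f) → Covers (T ─ b) f
    covers-◃ T b f cov c Tc with c Fin.≟ b | cov c
    ... | no c≢b | cov-c with cov-c Tc
    ...   | zero  , b≡c  = ⊥-elim (c≢b (sym b≡c))
    ...   | suc a , fa≡c = a , fa≡c

    covers-◃⁻ : ∀ T b {m} (f : Fin m → Fin y) → Covers (T ─ b) f → Covers T (b ◃ f)
    covers-◃⁻ T b f cov c Tc with c Fin.≟ b | cov c
    ... | yes c≡b | _     = zero , sym c≡b
    ... | no _    | cov-c = let a , fa≡c = cov-c Tc in suc a , fa≡c

    size-─ : ∀ T b → ∣ T ─ b ∣ + χ (T b Bool.≟ true) ≡ ∣ T ∣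
    size-─ T b = begin
      ∣ T ─ b ∣ + χ (T b Bool.≟ true)
        ≡⟨ cong (∣ T ─ b ∣ +_) (∑-pick (λ c → χ (T c Bool.≟ true)) b) ⟨
      ∣ T ─ b ∣ + ∑[ c < y ] (χ (c Fin.≟ b) * χ (T c Bool.≟ true))
        ≡⟨ ∑-distrib-+ (λ c → χ ((T ─ b) c Bool.≟ true)) _ ⟨
      ∑[ c < y ] (χ ((T ─ b) c Bool.≟ true) + χ (c Fin.≟ b) * χ (T c Bool.≟ true))
        ≡⟨ ∑-cong y pointwise ⟩
      ∣ T ∣ ∎
      where
      open ≡-Reasoning
      pointwise : ∀ c → χ ((T ─ b) c Bool.≟ true) + χ (c Fin.≟ b) * χ (T c Bool.≟ true) ≡ χ (T c Bool.≟ true)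
      pointwise c with c Fin.≟ b
      ... | yes _ = ℕP.+-identityʳ _
      ... | no _  = ℕP.+-identityʳ _

    cover-count : ∀ m T → ∑ᵗ m (λ f → χ (Covers? T f)) ≡ coverNumber y m ∣ T ∣
    cover-count zero T = χ-cong (Covers? T _) (∣ T ∣ ℕ.≟ 0) nothing-covered empty-covered
      where
      nothing-covered : Covers T {zero} (λ ()) → ∣ T ∣ ≡ 0
      nothing-covered cov = trans (∑-cong y (λ c → χ-no (T c Bool.≟ true) (λ Tc → no-entry (cov c Tc)))) (sum-replicate-zero y)
        where
        no-entry : ∀ {c : Fin y} {f : Fin zero → Fin y} → ¬ (∃ λ a → f a ≡ c)
        no-entry (() , _)
      empty-covered : ∣ T ∣ ≡ 0 → Covers T {zero} (λ ())
      empty-covered ∣T∣≡0 c Tc = ⊥-elim (ℕP.1+n≢0 (ℕP.m+n≡0⇒n≡0 ∣ T ─ c ∣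
        (trans (cong (∣ T ─ c ∣ +_) (sym (χ-yes (T c Bool.≟ true) Tc))) (trans (size-─ T c) ∣T∣≡0))))
    cover-count (suc m) T = begin
      ∑[ b < y ] ∑ᵗ m (λ f → χ (Covers? T (b ◃ f)))
        ≡⟨ ∑-cong y (λ b → ∑ᵗ-cong m (λ f → χ-cong (Covers? T (b ◃ f)) (Covers? (T ─ b) f) (covers-◃ T b f) (covers-◃⁻ T b f))) ⟩
      ∑[ b < y ] ∑ᵗ m (λ f → χ (Covers? (T ─ b) f))
        ≡⟨ ∑-cong y (λ b → trans (cover-count m (T ─ b)) (split b)) ⟩
      ∑[ b < y ] (χ (T b Bool.≟ true) * coverNumber y m (∣ T ∣ ∸ 1) + χ (¬? (T b Bool.≟ true)) * coverNumber y m ∣ T ∣)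
        ≡⟨ ∑-linear y _ _ _ _ ⟩
      ∣ T ∣ * coverNumber y m (∣ T ∣ ∸ 1) + ∑[ b < y ] χ (¬? (T b Bool.≟ true)) * coverNumber y m ∣ T ∣
        ≡⟨ cong (λ n → ∣ T ∣ * coverNumber y m (∣ T ∣ ∸ 1) + n * coverNumber y m ∣ T ∣) outside ⟩
      coverNumber y (suc m) ∣ T ∣ ∎
      where
      open ≡-Reasoning
      split : ∀ b → coverNumber y m ∣ T ─ b ∣
        ≡ χ (T b Bool.≟ true) * coverNumber y m (∣ T ∣ ∸ 1) + χ (¬? (T b Bool.≟ true)) * coverNumber y m ∣ T ∣
      split b with T b Bool.≟ true | size-─ T b
      ... | yes _ | eq = trans (cong (coverNumber y m) (trans (sym (ℕP.m+n∸n≡m _ 1)) (cong (_∸ 1) eq)))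
                               (sym (trans (ℕP.+-identityʳ _) (ℕP.+-identityʳ _)))
      ... | no _  | eq = trans (cong (coverNumber y m) (trans (sym (ℕP.+-identityʳ _)) eq)) (sym (ℕP.+-identityʳ _))
      outside : ∑[ b < y ] χ (¬? (T b Bool.≟ true)) ≡ y ∸ ∣ T ∣
      outside = begin
        ∑[ b < y ] χ (¬? (T b Bool.≟ true))                  ≡⟨ ℕP.m+n∸n≡m _ ∣ T ∣ ⟨
        ∑[ b < y ] χ (¬? (T b Bool.≟ true)) + ∣ T ∣ ∸ ∣ T ∣  ≡⟨ cong (_∸ ∣ T ∣) (∑-distrib-+ (λ b → χ (¬? (T b Bool.≟ true))) _) ⟨
        ∑[ b < y ] (χ (¬? (T b Bool.≟ true)) + χ (T b Bool.≟ true)) ∸ ∣ T ∣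
          ≡⟨ cong (_∸ ∣ T ∣) (trans (∑-cong y (λ b → χ-¬ (T b Bool.≟ true))) (trans (∑-const y 1) (ℕP.*-identityʳ y))) ⟩
        y ∸ ∣ T ∣ ∎

    surjections-as-coverings : ∀ m → 𝒮 m y ≡ coverNumber y m y
    surjections-as-coverings m = begin
      𝒮 m y                                                  ≡⟨ count-allFunctions m Surjective? surj-resp ⟩
      ∑ᵗ m (λ f → χ (Surjective? f))                         ≡⟨ ∑ᵗ-cong m (λ f → χ-cong (Surjective? f) (Covers? full f) (λ s c _ → s c) (λ cov c → cov c refl)) ⟩
      ∑ᵗ m (λ f → χ (Covers? full f))                        ≡⟨ cover-count m full ⟩
      coverNumber y m ∣ full ∣                               ≡⟨ cong (coverNumber y m) (trans (∑-const y 1) (ℕP.*-identityʳ y)) ⟩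
      coverNumber y m y                                      ∎
      where
      open ≡-Reasoning
      full : Fin y → Bool
      full _ = true
      surj-resp : ∀ {f f′ : Fin m → Fin y} → f ≗ f′ → (∀ b → ∃ λ a → f a ≡ b) → ∀ b → ∃ λ a → f′ a ≡ b
      surj-resp f≗f′ s b = let a , fa≡b = s b in a , trans (sym (f≗f′ a)) fa≡b

  -- Enlarging the codomain by a new point: a covering of T ⊆ Fin y with
  -- values in Fin (suc y) either also covers the new point or avoids it.
  coverNumber-suc : ∀ y m t → t ≤ y → coverNumber (suc y) m t ≡ coverNumber (suc y) m (suc t) + coverNumber y m t
  coverNumber-suc y zero    t       _   = refl
  coverNumber-suc y (suc m) zero    _   = begin
    suc y * H′ 0                                     ≡⟨ cong (suc y *_) (coverNumber-suc y m 0 z≤n) ⟩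
    suc y * (H′ 1 + H 0)                             ≡⟨ distribute y (H′ 1) (H 0) ⟩
    (1 * (H′ 1 + H 0) + y * H′ 1) + y * H 0          ≡⟨ cong (λ x → (1 * x + y * H′ 1) + y * H 0) (coverNumber-suc y m 0 z≤n) ⟨
    (1 * H′ 0 + y * H′ 1) + y * H 0                  ∎
    where
    open ≡-Reasoning
    H′ H : ℕ → ℕ
    H′ = coverNumber (suc y) m
    H  = coverNumber y m
    distribute : ∀ y a b → suc y * (a + b) ≡ (1 * (a + b) + y * a) + y * b
    distribute = solve-∀
  coverNumber-suc y (suc m) (suc t) t<y = begin
    suc t * H′ t + (y ∸ t) * H′ (suc t)
      ≡⟨ cong₂ (λ a u → suc t * a + u * H′ (suc t)) (coverNumber-suc y m t (ℕP.<⇒≤ t<y)) (ℕP.+-∸-assoc 1 t<y) ⟩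
    suc t * (H′ (suc t) + H t) + suc (y ∸ suc t) * H′ (suc t)
      ≡⟨ cong (λ a → suc t * (a + H t) + suc (y ∸ suc t) * a) (coverNumber-suc y m (suc t) t<y) ⟩
    suc t * ((H′ (suc (suc t)) + H (suc t)) + H t) + suc (y ∸ suc t) * (H′ (suc (suc t)) + H (suc t))
      ≡⟨ regroup t (y ∸ suc t) (H′ (suc (suc t))) (H (suc t)) (H t) ⟩
    (suc (suc t) * (H′ (suc (suc t)) + H (suc t)) + (y ∸ suc t) * H′ (suc (suc t))) + (suc t * H t + (y ∸ suc t) * H (suc t))
      ≡⟨ cong (λ a → (suc (suc t) * a + (y ∸ suc t) * H′ (suc (suc t))) + (suc t * H t + (y ∸ suc t) * H (suc t)))
              (coverNumber-suc y m (suc t) t<y) ⟨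
    (suc (suc t) * H′ (suc t) + (y ∸ suc t) * H′ (suc (suc t))) + (suc t * H t + (y ∸ suc t) * H (suc t)) ∎
    where
    open ≡-Reasoning
    H′ H : ℕ → ℕ
    H′ = coverNumber (suc y) m
    H  = coverNumber y m
    regroup : ∀ t u c d b → suc t * ((c + d) + b) + suc u * (c + d) ≡ (suc (suc t) * (c + d) + u * c) + (suc t * b + u * d)
    regroup = solve-∀

  𝒮-suc : ∀ m s → 𝒮 (suc m) (suc s) ≡ suc s * (𝒮 m (suc s) + 𝒮 m s)
  𝒮-suc m s = begin
    𝒮 (suc m) (suc s)
      ≡⟨ Covering.surjections-as-coverings (suc s) (suc m) ⟩
    suc s * coverNumber (suc s) m s + (s ∸ s) * coverNumber (suc s) m (suc s)
      ≡⟨ cong (λ n → suc s * coverNumber (suc s) m s + n * coverNumber (suc s) m (suc s)) (ℕP.n∸n≡0 s) ⟩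
    suc s * coverNumber (suc s) m s + 0
      ≡⟨ ℕP.+-identityʳ _ ⟩
    suc s * coverNumber (suc s) m s
      ≡⟨ cong (suc s *_) (coverNumber-suc s m s ℕP.≤-refl) ⟩
    suc s * (coverNumber (suc s) m (suc s) + coverNumber s m s)
      ≡⟨ cong (suc s *_) (cong₂ _+_ (Covering.surjections-as-coverings (suc s) m) (Covering.surjections-as-coverings s m)) ⟨
    suc s * (𝒮 m (suc s) + 𝒮 m s) ∎
    where open ≡-Reasoning

  ℕ→ℚᵘ : ∀ n → ℚ.toℚᵘ (ℕ→ℚ n) ℚᵘ.≃ mkℚᵘ (ℤ.+ n) 0
  ℕ→ℚᵘ n = ℚP.toℚᵘ-fromℚᵘ (mkℚᵘ (ℤ.+ n) 0)

  ℕ→ℚ-+ : ∀ a b → ℕ→ℚ (a + b) ≡ ℕ→ℚ a ℚ.+ ℕ→ℚ b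
  ℕ→ℚ-+ a b = ℚP.toℚᵘ-injective (ℚᵘP.≃-trans (ℕ→ℚᵘ (a + b)) (ℚᵘP.≃-trans sumᵘ
    (ℚᵘP.≃-sym (ℚᵘP.≃-trans (ℚP.toℚᵘ-homo-+ (ℕ→ℚ a) (ℕ→ℚ b)) (ℚᵘP.+-cong (ℕ→ℚᵘ a) (ℕ→ℚᵘ b))))))
    where
    sumᵘ : mkℚᵘ (ℤ.+ (a + b)) 0 ℚᵘ.≃ mkℚᵘ (ℤ.+ a) 0 ℚᵘ.+ mkℚᵘ (ℤ.+ b) 0
    sumᵘ = *≡* (trans (ℤP.*-identityʳ _) (trans (ℤP.pos-+ a b)
             (sym (trans (ℤP.*-identityʳ _) (cong₂ ℤ._+_ (ℤP.*-identityʳ (ℤ.+ a)) (ℤP.*-identityʳ (ℤ.+ b)))))))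

  ℕ→ℚ-* : ∀ a b → ℕ→ℚ (a * b) ≡ ℕ→ℚ a ℚ.* ℕ→ℚ b
  ℕ→ℚ-* a b = ℚP.toℚᵘ-injective (ℚᵘP.≃-trans (ℕ→ℚᵘ (a * b)) (ℚᵘP.≃-trans productᵘ
    (ℚᵘP.≃-sym (ℚᵘP.≃-trans (ℚP.toℚᵘ-homo-* (ℕ→ℚ a) (ℕ→ℚ b)) (ℚᵘP.*-cong (ℕ→ℚᵘ a) (ℕ→ℚᵘ b))))))
    where
    productᵘ : mkℚᵘ (ℤ.+ (a * b)) 0 ℚᵘ.≃ mkℚᵘ (ℤ.+ a) 0 ℚᵘ.* mkℚᵘ (ℤ.+ b) 0
    productᵘ = *≡* (trans (ℤP.*-identityʳ _) (trans (ℤP.pos-* a b) (sym (ℤP.*-identityʳ _))))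

  ℕ→ℚ-/ : ∀ a b n c .{{_ : ℕ.NonZero b}} → n * b ≡ a * c → (ℤ.+ a ℚ./ b) ℚ.* ℕ→ℚ c ≡ ℕ→ℚ n
  ℕ→ℚ-/ a (suc b) n c n*b≡a*c = ℚP.toℚᵘ-injective (ℚᵘP.≃-trans
    (ℚᵘP.≃-trans (ℚP.toℚᵘ-homo-* (ℤ.+ a ℚ./ suc b) (ℕ→ℚ c)) (ℚᵘP.*-cong (ℚP.toℚᵘ-fromℚᵘ (mkℚᵘ (ℤ.+ a) b)) (ℕ→ℚᵘ c)))
    (ℚᵘP.≃-trans quotientᵘ (ℚᵘP.≃-sym (ℕ→ℚᵘ n))))
    where
    quotientᵘ : mkℚᵘ (ℤ.+ a) b ℚᵘ.* mkℚᵘ (ℤ.+ c) 0 ℚᵘ.≃ mkℚᵘ (ℤ.+ n) 0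
    quotientᵘ = *≡* (trans (ℤP.*-identityʳ _) (trans (sym (ℤP.pos-* a c)) (trans (cong ℤ.+_ (sym n*b≡a*c))
              (trans (cong (λ t → ℤ.+ (n * suc t)) (sym (ℕP.*-identityʳ b))) (ℤP.pos-* n (suc (b * 1)))))))

  ℕ→ℚ-∑₁ : ∀ n (g : ℕ → ℕ) → ℕ→ℚ (∑₁ n g) ≡ sum1 n (ℕ→ℚ ∘ g)
  ℕ→ℚ-∑₁ zero    g = refl
  ℕ→ℚ-∑₁ (suc n) g = trans (ℕ→ℚ-+ (∑₁ n g) (g (suc n))) (cong (ℚ._+ ℕ→ℚ (g (suc n))) (ℕ→ℚ-∑₁ n g))

  sum1-cong : ∀ n {g h : ℕ → ℚ} → (∀ t → g t ≡ h t) → sum1 n g ≡ sum1 n h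
  sum1-cong zero    eq = refl
  sum1-cong (suc n) eq = cong₂ ℚ._+_ (sum1-cong n eq) (eq (suc n))

  ℕ→ℚ-pred : ∀ c K → c + 1 ≡ K → ℕ→ℚ c ≡ ℕ→ℚ K ℚ.- ℚ.1ℚ
  ℕ→ℚ-pred c K c+1≡K = trans (add-sub (ℕ→ℚ c)) (cong (ℚ._- ℚ.1ℚ) (trans (sym (ℕ→ℚ-+ c 1)) (cong ℕ→ℚ c+1≡K)))
    where
    open ℚSolver
    add-sub : ∀ x → x ≡ (x ℚ.+ ℚ.1ℚ) ℚ.- ℚ.1ℚ
    add-sub = solve 1 (λ x → x := (x :+ con ℚ.1ℚ) :- con ℚ.1ℚ) refl

  count-in-ℚ : ∀ c v Q a P → c + 1 ≡ v * Q → v + a ≡ P → ℕ→ℚ c ≡ ℕ→ℚ Q ℚ.* (ℕ→ℚ P ℚ.- ℕ→ℚ a) ℚ.- ℚ.1ℚ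
  count-in-ℚ c v Q a P c+1≡vQ v+a≡P = begin
    ℕ→ℚ c                                              ≡⟨ ℕ→ℚ-pred c (v * Q) c+1≡vQ ⟩
    ℕ→ℚ (v * Q) ℚ.- ℚ.1ℚ                               ≡⟨ cong (ℚ._- ℚ.1ℚ) (ℕ→ℚ-* v Q) ⟩
    ℕ→ℚ v ℚ.* ℕ→ℚ Q ℚ.- ℚ.1ℚ                          ≡⟨ regroup (ℕ→ℚ v) (ℕ→ℚ Q) (ℕ→ℚ a) ⟩
    ℕ→ℚ Q ℚ.* ((ℕ→ℚ v ℚ.+ ℕ→ℚ a) ℚ.- ℕ→ℚ a) ℚ.- ℚ.1ℚ ≡⟨ cong (λ x → ℕ→ℚ Q ℚ.* (x ℚ.- ℕ→ℚ a) ℚ.- ℚ.1ℚ) (trans (sym (ℕ→ℚ-+ v a)) (cong ℕ→ℚ v+a≡P)) ⟩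
    ℕ→ℚ Q ℚ.* (ℕ→ℚ P ℚ.- ℕ→ℚ a) ℚ.- ℚ.1ℚ             ∎
    where
    open ≡-Reasoning
    open ℚSolver
    regroup : ∀ v Q a → v ℚ.* Q ℚ.- ℚ.1ℚ ≡ Q ℚ.* ((v ℚ.+ a) ℚ.- a) ℚ.- ℚ.1ℚ
    regroup = solve 3 (λ v Q a → v :* Q :- con ℚ.1ℚ := Q :* ((v :+ a) :- a) :- con ℚ.1ℚ) refl

  subtract-sum : ∀ Q P a b → Q ℚ.* (P ℚ.- (a ℚ.+ b)) ℚ.- ℚ.1ℚ ≡ Q ℚ.* (P ℚ.- a ℚ.- b) ℚ.- ℚ.1ℚ
  subtract-sum = solve 4 (λ Q P a b → Q :* (P :- (a :+ b)) :- con ℚ.1ℚ := Q :* ((P :- a) :- b) :- con ℚ.1ℚ) refl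
    where open ℚSolver

  falling-vanishes : ∀ q h → q < h → falling q h ≡ 0
  falling-vanishes q (suc h) (s≤s q≤h) with q ℕ.≟ h
  ... | yes refl = trans (cong (falling q q *_) (ℕP.n∸n≡0 q)) (ℕP.*-zeroʳ (falling q q))
  ... | no q≢h   = cong (_* (q ∸ h)) (falling-vanishes q h (ℕP.≤∧≢⇒< q≤h q≢h))

  oddFalling-vanishes : ∀ X t → X < t → oddFalling (suc (2 * X)) t ≡ 0
  oddFalling-vanishes X (suc t) (s≤s X≤t) with X ℕ.≟ t
  ... | yes refl = trans (cong (oddFalling (suc (2 * X)) X *_) last-factor) (ℕP.*-zeroʳ (oddFalling (suc (2 * X)) X))
    where
    last-factor : suc (2 * X) ∸ (2 * X + 1) ≡ 0
    last-factor = trans (cong (suc (2 * X) ∸_) (ℕP.+-comm (2 * X) 1)) (ℕP.n∸n≡0 (suc (2 * X)))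
  ... | no X≢t   = cong (_* (suc (2 * X) ∸ (2 * t + 1))) (oddFalling-vanishes X t (ℕP.≤∧≢⇒< X≤t X≢t))

  module FieldCounting (F : FiniteField) where

    open FiniteField F hiding (zero)
      renaming (_+_ to _⊕_; _*_ to _⊗_; refl to ≈-refl; sym to ≈-sym; trans to ≈-trans)
    open import Algebra.Properties.Ring ring using (-‿involutive; -0#≈0#; +-inverseˡ-unique; +-cancelˡ)
    module ≈-Reasoning = Relation.Binary.Reasoning.Setoid setoid

    q : ℕ
    q = size

    e : Fin q → Carrier
    e = Inverse.to enum

    e⁻¹ : Carrier → Fin q
    e⁻¹ = Inverse.from enum

    e⁻¹-cong : ∀ {a b} → a ≈ b → e⁻¹ a ≡ e⁻¹ b
    e⁻¹-cong = Inverse.from-cong enum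

    e-e⁻¹ : ∀ a → e (e⁻¹ a) ≈ a
    e-e⁻¹ = Inverse.strictlyInverseˡ enum

    e⁻¹-injective : ∀ {a b} → e⁻¹ a ≡ e⁻¹ b → a ≈ b
    e⁻¹-injective {a} {b} eq = ≈-trans (≈-sym (e-e⁻¹ a)) (≈-trans (reflexive (cong e eq)) (e-e⁻¹ b))

    open TupleSum e public

    ∑F : (Carrier → ℕ) → ℕ
    ∑F g = ∑[ i < q ] g (e i)

    ∑F-cong : ∀ {g h : Carrier → ℕ} → (∀ a → g a ≡ h a) → ∑F g ≡ ∑F h
    ∑F-cong eq = ∑-cong q (λ i → eq (e i))

    ∑F-one : ∑F (λ _ → 1) ≡ q
    ∑F-one = trans (∑-const q 1) (ℕP.*-identityʳ q)

    Respects≈ : (Carrier → ℕ) → Set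
    Respects≈ g = ∀ {a b} → a ≈ b → g a ≡ g b

    ∑F-pick : ∀ c (g : Carrier → ℕ) → Respects≈ g → ∑F (λ a → χ (a ≟ c) * g a) ≡ g c
    ∑F-pick c g g-resp = begin
      ∑[ i < q ] (χ (e i ≟ c) * g (e i))          ≡⟨ ∑-cong q (λ i → cong (_* g (e i)) (χ-cong (e i ≟ c) (i Fin.≟ e⁻¹ c) to from)) ⟩
      ∑[ i < q ] (χ (i Fin.≟ e⁻¹ c) * g (e i))    ≡⟨ ∑-pick (g ∘ e) (e⁻¹ c) ⟩
      g (e (e⁻¹ c))                               ≡⟨ g-resp (e-e⁻¹ c) ⟩
      g c                                         ∎
      where
      open ≡-Reasoning
      to : ∀ {i} → e i ≈ c → i ≡ e⁻¹ c
      to {i} eic = trans (sym (Inverse.strictlyInverseʳ enum i)) (e⁻¹-cong eic)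
      from : ∀ {i} → i ≡ e⁻¹ c → e i ≈ c
      from refl = e-e⁻¹ c

    ∑F-pick′ : ∀ c (g : Carrier → ℕ) → Respects≈ g → ∑F (λ a → χ (c ≟ a) * g a) ≡ g c
    ∑F-pick′ c g g-resp =
      trans (∑F-cong (λ a → cong (_* g a) (χ-cong (c ≟ a) (a ≟ c) ≈-sym ≈-sym))) (∑F-pick c g g-resp)

    ∑ᵗ-suc : ∀ m (g : (Fin (suc m) → Carrier) → ℕ) → ∑ᵗ (suc m) g ≡ ∑ᵗ m (λ f → ∑F (λ a → g (a ◃ f)))
    ∑ᵗ-suc m g = sym (∑ᵗ-comm m q (λ i f → g (e i ◃ f)))

    ∑F-involution : (σ : Carrier → Carrier) → (∀ {a b} → a ≈ b → σ a ≈ σ b) → (∀ a → σ (σ a) ≈ a) →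
      ∀ g → Respects≈ g → ∑F (g ∘ σ) ≡ ∑F g
    ∑F-involution σ σ-cong σσ g g-resp = begin
      ∑[ i < q ] g (σ (e i))           ≡⟨ ∑-cong q (λ i → g-resp (≈-sym (e-e⁻¹ (σ (e i))))) ⟩
      ∑[ i < q ] g (e (π ⟨$⟩ʳ i))      ≡⟨ ∑-permute (g ∘ e) π ⟨
      ∑[ i < q ] g (e i)               ∎
      where
      open ≡-Reasoning
      π̂ : Fin q → Fin q
      π̂ i = e⁻¹ (σ (e i))
      π̂-involutive : ∀ i → π̂ (π̂ i) ≡ i
      π̂-involutive i = trans (e⁻¹-cong (≈-trans (σ-cong (e-e⁻¹ (σ (e i)))) (σσ (e i)))) (Inverse.strictlyInverseʳ enum i)
      π : Permutation q q
      π = permutation π̂ π̂ π̂-involutive π̂-involutive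

    involution-even : (σ : Carrier → Carrier) → (∀ {a b} → a ≈ b → σ a ≈ σ b) → (∀ a → σ (σ a) ≈ a) →
      {U : Carrier → Set} (U? : ∀ a → Dec (U a)) → (∀ {a b} → a ≈ b → U a → U b) →
      (∀ {a} → U a → U (σ a)) → (∀ {a} → U a → ¬ σ a ≈ a) →
      ∃ λ k → ∑F (λ a → χ (U? a)) ≡ 2 * k
    involution-even σ σ-cong σσ {U} U? U-resp U-σ no-fix = ∑F first , (begin
      ∑F (λ a → χ (U? a))                                      ≡⟨ ∑F-cong (λ a → split a) ⟩
      ∑F (λ a → first a + first (σ a))                        ≡⟨ ∑-distrib-+ (first ∘ e) (first ∘ σ ∘ e) ⟩
      ∑F first + ∑F (first ∘ σ)                               ≡⟨ cong (∑F first +_) (∑F-involution σ σ-cong σσ first first-resp) ⟩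
      ∑F first + ∑F first                                     ≡⟨ cong (∑F first +_) (ℕP.+-identityʳ (∑F first)) ⟨
      2 * ∑F first                                            ∎)
      where
      open ≡-Reasoning
      Before : Carrier → Set
      Before a = toℕ (e⁻¹ a) < toℕ (e⁻¹ (σ a))
      Before? : ∀ a → Dec (Before a)
      Before? a = toℕ (e⁻¹ a) ℕ.<? toℕ (e⁻¹ (σ a))
      -- each pair {a, σ a} is counted once, at its element of lower rank
      first : Carrier → ℕ
      first a = χ (U? a ×-dec Before? a)
      first-resp : Respects≈ first
      first-resp a≈b = χ-cong (U? _ ×-dec Before? _) (U? _ ×-dec Before? _)
        (λ (u , r) → U-resp a≈b u , subst₂ _<_ (rank a≈b) (rank (σ-cong a≈b)) r)
        (λ (u , r) → U-resp (≈-sym a≈b) u , subst₂ _<_ (rank (≈-sym a≈b)) (rank (σ-cong (≈-sym a≈b))) r)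
        where rank : ∀ {a b} → a ≈ b → toℕ (e⁻¹ a) ≡ toℕ (e⁻¹ b)
              rank = cong toℕ ∘ e⁻¹-cong
      split : ∀ a → χ (U? a) ≡ first a + first (σ a)
      split a with U? a | U? (σ a)
      ... | no _  | no _    = refl
      ... | no ¬u | yes uσ  = ⊥-elim (¬u (U-resp (σσ a) (U-σ uσ)))
      ... | yes u | no ¬uσ  = ⊥-elim (¬uσ (U-σ u))
      ... | yes u | yes _   with Before? a | Before? (σ a)
      ...   | yes _ | no _  = refl
      ...   | no _  | yes _ = refl
      ...   | yes r | yes r′ = ⊥-elim (ℕP.<-asym r (subst (toℕ (e⁻¹ (σ a)) <_) (cong toℕ (e⁻¹-cong (σσ a))) r′))
      ...   | no ¬r | no ¬r′ = ⊥-elim (¬r′ (subst (toℕ (e⁻¹ (σ a)) <_) (sym (cong toℕ (e⁻¹-cong (σσ a))))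
                                  (ℕP.≤∧≢⇒< (ℕP.≮⇒≥ ¬r) distinct)))
        where
        distinct : toℕ (e⁻¹ (σ a)) ≢ toℕ (e⁻¹ a)
        distinct eq = no-fix u (e⁻¹-injective (toℕ-injective eq))

    no-zero-divisors : ∀ {x y} → x ⊗ y ≈ 0# → x ≈ 0# ⊎ y ≈ 0#
    no-zero-divisors {x} {y} xy≈0 with x ≟ 0#
    ... | yes x≈0 = inj₁ x≈0
    ... | no x≉0 with inverse x x≉0
    ... | x⁻¹ , xx⁻¹≈1 = inj₂ (begin
      y                 ≈⟨ *-identityˡ y ⟨
      1# ⊗ y            ≈⟨ *-congʳ xx⁻¹≈1 ⟨
      (x ⊗ x⁻¹) ⊗ y     ≈⟨ *-congʳ (*-comm x x⁻¹) ⟩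
      (x⁻¹ ⊗ x) ⊗ y     ≈⟨ *-assoc x⁻¹ x y ⟩
      x⁻¹ ⊗ (x ⊗ y)     ≈⟨ *-congˡ xy≈0 ⟩
      x⁻¹ ⊗ 0#          ≈⟨ zeroʳ x⁻¹ ⟩
      0#                ∎)
      where open ≈-Reasoning

    Char2 : Set
    Char2 = 1# ⊕ 1# ≈ 0#

    double : ∀ x → x ⊕ x ≈ (1# ⊕ 1#) ⊗ x
    double x = ≈-sym (≈-trans (distribʳ x 1# 1#) (+-cong (*-identityˡ x) (*-identityˡ x)))

    char2-neg : Char2 → ∀ x → - x ≈ x
    char2-neg char2 x = ≈-sym (+-inverseˡ-unique x x (≈-trans (double x) (≈-trans (*-congʳ char2) (zeroˡ x))))

    odd-neg : ¬ Char2 → ∀ {x} → - x ≈ x → x ≈ 0#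
    odd-neg ¬char2 {x} -x≈x with no-zero-divisors (≈-trans (≈-sym (double x)) (≈-trans (+-congʳ (≈-sym -x≈x)) (-‿inverseˡ x)))
    ... | inj₁ char2 = ⊥-elim (¬char2 char2)
    ... | inj₂ x≈0   = x≈0

    q-even : Char2 → ∃ λ k → q ≡ 2 * k
    q-even char2 =
      let k , total≡2k = involution-even (_⊕ 1#) (λ a≈b → +-congʳ a≈b) shift-twice (λ _ → yes tt) (λ _ _ → tt) (λ _ → tt) no-fix
      in k , trans (sym ∑F-one) total≡2k
      where
      shift-twice : ∀ a → (a ⊕ 1#) ⊕ 1# ≈ a
      shift-twice a = ≈-trans (+-assoc a 1# 1#) (≈-trans (+-congˡ char2) (+-identityʳ a))
      no-fix : ∀ {a} → ⊤ → ¬ (a ⊕ 1# ≈ a)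
      no-fix {a} _ a+1≈a = 0≉1 (≈-sym (+-cancelˡ a 1# 0# (≈-trans a+1≈a (≈-sym (+-identityʳ a)))))

    q-odd : ¬ Char2 → ∃ λ k → q ≡ suc (2 * k)
    q-odd ¬char2 =
      let k , nonzero≡2k = involution-even -_ -‿cong -‿involutive (λ a → ¬? (a ≟ 0#)) resp neg-nonzero no-fix
      in k , (begin
        q                                                   ≡⟨ ∑F-one ⟨
        ∑F (λ _ → 1)                                        ≡⟨ ∑F-cong (λ a → χ-¬ (a ≟ 0#)) ⟨
        ∑F (λ a → χ (¬? (a ≟ 0#)) + χ (a ≟ 0#))             ≡⟨ ∑-distrib-+ (λ i → χ (¬? (e i ≟ 0#))) (λ i → χ (e i ≟ 0#)) ⟩
        ∑F (λ a → χ (¬? (a ≟ 0#))) + ∑F (λ a → χ (a ≟ 0#))  ≡⟨ cong₂ _+_ nonzero≡2k zero-once ⟩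
        2 * k + 1                                           ≡⟨ ℕP.+-comm (2 * k) 1 ⟩
        suc (2 * k)                                         ∎)
      where
      open ≡-Reasoning
      resp : ∀ {a b} → a ≈ b → ¬ a ≈ 0# → ¬ b ≈ 0#
      resp a≈b a≉0 b≈0 = a≉0 (≈-trans a≈b b≈0)
      neg-nonzero : ∀ {a} → ¬ a ≈ 0# → ¬ - a ≈ 0#
      neg-nonzero {a} a≉0 -a≈0 = a≉0 (≈-trans (≈-sym (-‿involutive a)) (≈-trans (-‿cong -a≈0) -0#≈0#))
      no-fix : ∀ {a} → ¬ a ≈ 0# → ¬ - a ≈ a
      no-fix a≉0 -a≈a = a≉0 (odd-neg ¬char2 -a≈a)
      zero-once : ∑F (λ a → χ (a ≟ 0#)) ≡ 1
      zero-once = trans (∑F-cong (λ a → sym (ℕP.*-identityʳ (χ (a ≟ 0#))))) (∑F-pick 0# (λ _ → 1) (λ _ → refl))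

    q≢1 : q ≢ 1
    q≢1 q≡1 = 0≉1 (e⁻¹-injective (toℕ-injective (trans (rank-zero (e⁻¹ 0#)) (sym (rank-zero (e⁻¹ 1#))))))
      where
      rank-zero : ∀ (i : Fin q) → toℕ i ≡ 0
      rank-zero i = ℕP.n<1⇒n≡0 (subst (toℕ i <_) q≡1 (toℕ<n i))

    char2-of-2-power : ∀ n → q ≡ 2 ^ n → Char2
    char2-of-2-power zero    q≡1 = ⊥-elim (q≢1 q≡1)
    char2-of-2-power (suc n) q≡2^n with (1# ⊕ 1#) ≟ 0#
    ... | yes char2 = char2
    ... | no ¬char2 = let k , q≡odd = q-odd ¬char2 in ⊥-elim (ℕP.even≢odd (2 ^ n) k (trans (sym q≡2^n) q≡odd))

    ¬char2-of-odd-prime-power : ∀ {p} n → Prime p → 2 < p → q ≡ p ^ n → ¬ Char2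
    ¬char2-of-odd-prime-power {p} n p-prime 2<p q≡pⁿ char2 =
      let k , q≡2k = q-even char2 in 2∤pⁿ n (divides k (trans (sym q≡pⁿ) (trans q≡2k (ℕP.*-comm 2 k))))
      where
      2∤pⁿ : ∀ n → ¬ 2 ∣ p ^ n
      2∤pⁿ zero 2∣1 with ∣1⇒≡1 2∣1
      ... | ()
      2∤pⁿ (suc n) 2∣pⁿ⁺¹ with euclidsLemma p (p ^ n) prime[2] 2∣pⁿ⁺¹
      ... | inj₂ 2∣pⁿ = 2∤pⁿ n 2∣pⁿ
      ... | inj₁ 2∣p with prime⇒irreducible p-prime 2∣p
      ...   | inj₁ ()
      ...   | inj₂ 2≡p = ℕP.<-irrefl 2≡p 2<p

    Occurs : Carrier → ∀ {n} → (Fin n → Carrier) → Set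
    Occurs a {zero}  f = ⊥
    Occurs a {suc n} f = f zero ≈ a ⊎ Occurs a (f ∘ suc)

    Occurs? : ∀ a {n} (f : Fin n → Carrier) → Dec (Occurs a f)
    Occurs? a {zero}  f = no (λ ())
    Occurs? a {suc n} f = (f zero ≟ a) ⊎-dec Occurs? a (f ∘ suc)

    Occurs-resp : ∀ {a b n} (f : Fin n → Carrier) → a ≈ b → Occurs a f → Occurs b f
    Occurs-resp {n = suc n} f a≈b (inj₁ f₀≈a) = inj₁ (≈-trans f₀≈a a≈b)
    Occurs-resp {n = suc n} f a≈b (inj₂ occ)  = inj₂ (Occurs-resp (f ∘ suc) a≈b occ)

    χ-Occurs-resp : ∀ {n} (f : Fin n → Carrier) → Respects≈ (λ a → χ (Occurs? a f))
    χ-Occurs-resp f a≈b = χ-cong (Occurs? _ f) (Occurs? _ f) (Occurs-resp f a≈b) (Occurs-resp f (≈-sym a≈b))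

    χ-¬Occurs-resp : ∀ {n} (f : Fin n → Carrier) → Respects≈ (λ a → χ (¬? (Occurs? a f)))
    χ-¬Occurs-resp f a≈b = χ-cong (¬? (Occurs? _ f)) (¬? (Occurs? _ f))
      (λ ¬occ occ → ¬occ (Occurs-resp f (≈-sym a≈b) occ)) (λ ¬occ occ → ¬occ (Occurs-resp f a≈b occ))

    -- overValues w f is the sum of w over the set of values of f:
    -- each value is counted at its last occurrence.
    overValues : (Carrier → ℕ) → ∀ {n} → (Fin n → Carrier) → ℕ
    overValues w {zero}  f = 0
    overValues w {suc n} f = χ (¬? (Occurs? (f zero) (f ∘ suc))) * w (f zero) + overValues w (f ∘ suc)

    ∑-over-occurring : ∀ (w : Carrier → ℕ) → Respects≈ w → ∀ {n} (f : Fin n → Carrier) →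
      ∑F (λ a → χ (Occurs? a f) * w a) ≡ overValues w f
    ∑-over-occurring w w-resp {zero}  f = sum-replicate-zero q
    ∑-over-occurring w w-resp {suc n} f = begin
      ∑F (λ a → χ (Occurs? a f) * w a)
        ≡⟨ ∑F-cong (λ a → split a) ⟩
      ∑F (λ a → χ (Occurs? a f′) * w a + χ (f zero ≟ a) * new a)
        ≡⟨ ∑-distrib-+ (λ i → χ (Occurs? (e i) f′) * w (e i)) (λ i → χ (f zero ≟ e i) * new (e i)) ⟩
      ∑F (λ a → χ (Occurs? a f′) * w a) + ∑F (λ a → χ (f zero ≟ a) * new a)
        ≡⟨ cong₂ _+_ (∑-over-occurring w w-resp f′) (∑F-pick′ (f zero) new new-resp) ⟩
      overValues w f′ + new (f zero)
        ≡⟨ ℕP.+-comm (overValues w f′) _ ⟩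
      overValues w f ∎
      where
      open ≡-Reasoning
      f′ = f ∘ suc
      new : Carrier → ℕ
      new a = χ (¬? (Occurs? a f′)) * w a
      new-resp : Respects≈ new
      new-resp a≈b = cong₂ _*_ (χ-¬Occurs-resp f′ a≈b) (w-resp a≈b)
      split : ∀ a → χ (Occurs? a f) * w a ≡ χ (Occurs? a f′) * w a + χ (f zero ≟ a) * new a
      split a = begin
        χ (Occurs? a f) * w a
          ≡⟨ cong (_* w a) (χ-⊎ (f zero ≟ a) (Occurs? a f′)) ⟩
        (χ (Occurs? a f′) + χ (f zero ≟ a) * χ (¬? (Occurs? a f′))) * w a
          ≡⟨ ℕP.*-distribʳ-+ (w a) (χ (Occurs? a f′)) _ ⟩
        χ (Occurs? a f′) * w a + χ (f zero ≟ a) * χ (¬? (Occurs? a f′)) * w a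
          ≡⟨ cong (χ (Occurs? a f′) * w a +_) (ℕP.*-assoc (χ (f zero ≟ a)) _ (w a)) ⟩
        χ (Occurs? a f′) * w a + χ (f zero ≟ a) * new a ∎

    overValues-≤ : ∀ (w : Carrier → ℕ) → (∀ a → w a ≤ 1) → ∀ {n} (f : Fin n → Carrier) → overValues w f ≤ n
    overValues-≤ w w≤1 {zero}  f = z≤n
    overValues-≤ w w≤1 {suc n} f =
      ℕP.+-mono-≤ (ℕP.*-mono-≤ (χ≤1 (¬? (Occurs? (f zero) (f ∘ suc)))) (w≤1 (f zero))) (overValues-≤ w w≤1 (f ∘ suc))

    #values : ∀ {n} → (Fin n → Carrier) → ℕ
    #values = overValues (λ _ → 1)

    #nonzero : ∀ {n} → (Fin n → Carrier) → ℕ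
    #nonzero = overValues (λ a → χ (¬? (a ≟ 0#)))

    ∑-occurring : ∀ {n} (f : Fin n → Carrier) → ∑F (λ a → χ (Occurs? a f)) ≡ #values f
    ∑-occurring f =
      trans (∑F-cong (λ a → sym (ℕP.*-identityʳ (χ (Occurs? a f))))) (∑-over-occurring (λ _ → 1) (λ _ → refl) f)

    -- Negation permutes the field, so -f takes as many values as f.
    ∑-occurring-neg : ∀ {n} (f : Fin n → Carrier) → ∑F (λ a → χ (Occurs? (- a) f)) ≡ #values f
    ∑-occurring-neg f = trans (∑F-involution -_ -‿cong -‿involutive _ (χ-Occurs-resp f)) (∑-occurring f)

    -- Admissible tuples: no two entries add up to 0.  These are exactly
    -- the tuples outside D₂ (restricted to the first h coordinates).

    Admissible : ∀ {n} → (Fin n → Carrier) → Set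
    Admissible {zero}  f = ⊤
    Admissible {suc n} f = ¬ Occurs (- f zero) (f ∘ suc) × Admissible (f ∘ suc)

    Admissible? : ∀ {n} (f : Fin n → Carrier) → Dec (Admissible f)
    Admissible? {zero}  f = yes tt
    Admissible? {suc n} f = ¬? (Occurs? (- f zero) (f ∘ suc)) ×-dec Admissible? (f ∘ suc)

    free-choices : ∀ {n} (f : Fin n → Carrier) → ∑F (λ a → χ (¬? (Occurs? (- a) f))) + #values f ≡ q
    free-choices f = begin
      ∑F (λ a → χ (¬? (Occurs? (- a) f))) + #values f
        ≡⟨ cong (∑F (λ a → χ (¬? (Occurs? (- a) f))) +_) (∑-occurring-neg f) ⟨
      ∑F (λ a → χ (¬? (Occurs? (- a) f))) + ∑F (λ a → χ (Occurs? (- a) f))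
        ≡⟨ ∑-distrib-+ (λ i → χ (¬? (Occurs? (- e i) f))) (λ i → χ (Occurs? (- e i) f)) ⟨
      ∑F (λ a → χ (¬? (Occurs? (- a) f)) + χ (Occurs? (- a) f))
        ≡⟨ trans (∑F-cong (λ a → χ-¬ (Occurs? (- a) f))) ∑F-one ⟩
      q ∎
      where open ≡-Reasoning

    prodFin≈0 : ∀ {n} a (f : Fin n → Carrier) → prodFin F n (λ j → a ⊕ f j) ≈ 0# → Occurs (- a) f
    prodFin≈0 {zero}  a f 1≈0 = 0≉1 (≈-sym 1≈0)
    prodFin≈0 {suc n} a f prod≈0 with no-zero-divisors prod≈0
    ... | inj₁ a+f₀≈0 = inj₁ (+-inverseˡ-unique (f zero) a (≈-trans (+-comm (f zero) a) a+f₀≈0))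
    ... | inj₂ rest≈0 = inj₂ (prodFin≈0 a (f ∘ suc) rest≈0)

    prodFin≈0⁻ : ∀ {n} a (f : Fin n → Carrier) → Occurs (- a) f → prodFin F n (λ j → a ⊕ f j) ≈ 0#
    prodFin≈0⁻ {suc n} a f (inj₁ f₀≈-a) =
      ≈-trans (*-congʳ (≈-trans (+-congˡ f₀≈-a) (-‿inverseʳ a))) (zeroˡ _)
    prodFin≈0⁻ {suc n} a f (inj₂ occ)   = ≈-trans (*-congˡ (prodFin≈0⁻ a (f ∘ suc) occ)) (zeroʳ _)

    pairProd≈0 : ∀ {n} (f : Fin n → Carrier) → pairProd F n f ≈ 0# → ¬ Admissible f
    pairProd≈0 {zero}  f 1≈0 _ = 0≉1 (≈-sym 1≈0)
    pairProd≈0 {suc n} f pp≈0 (¬occ , adm) with no-zero-divisors pp≈0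
    ... | inj₁ prod≈0 = ¬occ (prodFin≈0 (f zero) (f ∘ suc) prod≈0)
    ... | inj₂ pp′≈0  = pairProd≈0 (f ∘ suc) pp′≈0 adm

    pairProd≈0⁻ : ∀ {n} (f : Fin n → Carrier) → ¬ Admissible f → pairProd F n f ≈ 0#
    pairProd≈0⁻ {zero}  f ¬adm = ⊥-elim (¬adm tt)
    pairProd≈0⁻ {suc n} f ¬adm with Occurs? (- f zero) (f ∘ suc)
    ... | yes occ = ≈-trans (*-congʳ (prodFin≈0⁻ (f zero) (f ∘ suc) occ)) (zeroˡ _)
    ... | no ¬occ = ≈-trans (*-congˡ (pairProd≈0⁻ (f ∘ suc) (λ adm → ¬adm (¬occ , adm)))) (zeroʳ _)

    pairProd-or-admissible : ∀ {n} (f : Fin n → Carrier) → χ (pairProd F n f ≟ 0#) + χ (Admissible? f) ≡ 1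
    pairProd-or-admissible f =
      trans (cong (_+ χ (Admissible? f)) (χ-cong (pairProd F _ f ≟ 0#) (¬? (Admissible? f)) (pairProd≈0 f) (pairProd≈0⁻ f)))
            (χ-¬ (Admissible? f))

    #admissible : ℕ → ℕ
    #admissible n = ∑ᵗ n (λ f → χ (Admissible? f))

    #vanishing : ℕ → ℕ
    #vanishing n = ∑ᵗ n (λ f → χ (pairProd F n f ≟ 0#))

    vanishing+admissible : ∀ n → #vanishing n + #admissible n ≡ q ^ n
    vanishing+admissible n = begin
      #vanishing n + #admissible n                                   ≡⟨ ∑ᵗ-distrib-+ n _ _ ⟨
      ∑ᵗ n (λ f → χ (pairProd F n f ≟ 0#) + χ (Admissible? f))       ≡⟨ ∑ᵗ-cong n pairProd-or-admissible ⟩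
      ∑ᵗ n (λ _ → 1)                                                 ≡⟨ ∑ᵗ-const n 1 ⟩
      q ^ n * 1                                                      ≡⟨ ℕP.*-identityʳ (q ^ n) ⟩
      q ^ n                                                          ∎
      where open ≡-Reasoning

    prodFin-cong : ∀ n {f f′ : Fin n → Carrier} → (∀ i → f i ≈ f′ i) → prodFin F n f ≈ prodFin F n f′
    prodFin-cong zero    f≈f′ = ≈-refl
    prodFin-cong (suc n) f≈f′ = *-cong (f≈f′ zero) (prodFin-cong n (f≈f′ ∘ suc))

    pairProd-cong : ∀ n {f f′ : Fin n → Carrier} → (∀ i → f i ≈ f′ i) → pairProd F n f ≈ pairProd F n f′
    pairProd-cong zero    f≈f′ = ≈-refl
    pairProd-cong (suc n) f≈f′ =
      *-cong (prodFin-cong n (λ j → +-cong (f≈f′ zero) (f≈f′ (suc j)))) (pairProd-cong n (f≈f′ ∘ suc))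

    -- The zero tuple is excluded from D₂ although x₁ + x₂ = 0 for it.
    zero-tuple-vanishes : ∀ n (f : Fin n → Carrier) → 2 ≤ n → (∀ i → f i ≈ 0#) → pairProd F n f ≈ 0#
    zero-tuple-vanishes (suc (suc n)) f _ f≈0 =
      ≈-trans (*-congʳ (≈-trans (*-congʳ (≈-trans (+-cong (f≈0 zero) (f≈0 (suc zero))) (+-identityˡ 0#))) (zeroˡ _))) (zeroˡ _)
    zero-tuple-vanishes (suc zero) f (s≤s ()) _

    AllZero? : ∀ {n} (f : Fin n → Carrier) → Dec (∀ i → f i ≈ 0#)
    AllZero? f = all? (λ i → f i ≟ 0#)

    one-zero-tuple : ∀ n → ∑ᵗ n (λ f → χ (AllZero? f)) ≡ 1
    one-zero-tuple zero    = refl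
    one-zero-tuple (suc n) = begin
      ∑ᵗ (suc n) (λ f → χ (AllZero? f))                      ≡⟨ ∑ᵗ-suc n (λ f → χ (AllZero? f)) ⟩
      ∑ᵗ n (λ f → ∑F (λ a → χ (AllZero? (a ◃ f))))           ≡⟨ ∑ᵗ-cong n (λ f → ∑F-cong (λ a → split a f)) ⟩
      ∑ᵗ n (λ f → ∑F (λ a → χ (a ≟ 0#) * χ (AllZero? f)))    ≡⟨ ∑ᵗ-cong n (λ f → ∑F-pick 0# (λ _ → χ (AllZero? f)) (λ _ → refl)) ⟩
      ∑ᵗ n (λ f → χ (AllZero? f))                            ≡⟨ one-zero-tuple n ⟩
      1                                                      ∎
      where
      open ≡-Reasoning
      split : ∀ a (f : Fin n → Carrier) → χ (AllZero? (a ◃ f)) ≡ χ (a ≟ 0#) * χ (AllZero? f)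
      split a f = trans (χ-cong (AllZero? (a ◃ f)) (a ≟ 0# ×-dec AllZero? f)
                                (λ z → z zero , z ∘ suc) (λ { (a≈0 , z) zero → a≈0 ; (a≈0 , z) (suc i) → z i }))
                        (χ-× (a ≟ 0#) (AllZero? f))

    cardD₂-as-sum : ∀ h k (h≤k : h ≤ k) → cardD₂ F h k h≤k ≡ ∑ᵗ k (λ f → χ (InD₂? F h k h≤k f))
    cardD₂-as-sum h k h≤k =
      trans (cong (λ xs → length (filter (InD₂? F h k h≤k) (allFunctions xs k))) (ListP.map-tabulate (λ i → i) e))
            (count-allFunctions k (InD₂? F h k h≤k) resp)
      where
      resp : ∀ {f f′ : Fin k → Carrier} → f ≗ f′ → InD₂ F h k h≤k f → InD₂ F h k h≤k f′
      resp f≗f′ (nonzero , pp≈0) =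
        (λ z → nonzero (λ i → ≈-trans (reflexive (f≗f′ i)) (z i))) ,
        ≈-trans (pairProd-cong h (λ i → reflexive (sym (f≗f′ (inject≤ i h≤k))))) pp≈0

    cardD₂-formula : ∀ h k (h≤k : h ≤ k) → 2 ≤ h → cardD₂ F h k h≤k + 1 ≡ #vanishing h * q ^ (k ∸ h)
    cardD₂-formula h k h≤k 2≤h = begin
      cardD₂ F h k h≤k + 1
        ≡⟨ cong₂ _+_ (cardD₂-as-sum h k h≤k) (sym (one-zero-tuple k)) ⟩
      ∑ᵗ k (λ f → χ (InD₂? F h k h≤k f)) + ∑ᵗ k (λ f → χ (AllZero? f))
        ≡⟨ ∑ᵗ-distrib-+ k _ _ ⟨
      ∑ᵗ k (λ f → χ (InD₂? F h k h≤k f) + χ (AllZero? f))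
        ≡⟨ ∑ᵗ-cong k (λ f → χ-¬×+ (AllZero? f) (pairProd F h (prefix f) ≟ 0#)
                                   (zero-tuple-vanishes h (prefix f) 2≤h ∘ (_∘ (λ i → inject≤ i h≤k)))) ⟩
      ∑ᵗ k (λ f → χ (pairProd F h (prefix f) ≟ 0#))
        ≡⟨ ∑ᵗ-prefix h≤k (λ f → χ (pairProd F h f ≟ 0#)) vanishing-resp ⟩
      #vanishing h * q ^ (k ∸ h) ∎
      where
      open ≡-Reasoning
      prefix : (Fin k → Carrier) → Fin h → Carrier
      prefix f i = f (inject≤ i h≤k)
      vanishing-resp : ∀ {f f′ : Fin h → Carrier} → f ≗ f′ → χ (pairProd F h f ≟ 0#) ≡ χ (pairProd F h f′ ≟ 0#)
      vanishing-resp f≗f′ = χ-cong (pairProd F h _ ≟ 0#) (pairProd F h _ ≟ 0#)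
        (≈-trans (pairProd-cong h (λ i → reflexive (sym (f≗f′ i))))) (≈-trans (pairProd-cong h (λ i → reflexive (f≗f′ i))))

    cardD₂-via-admissible : ∀ h k (h≤k : h ≤ k) → 2 ≤ h →
      ℕ→ℚ (cardD₂ F h k h≤k) ≡ ℕ→ℚ (q ^ (k ∸ h)) ℚ.* (ℕ→ℚ (q ^ h) ℚ.- ℕ→ℚ (#admissible h)) ℚ.- ℚ.1ℚ
    cardD₂-via-admissible h k h≤k 2≤h =
      count-in-ℚ (cardD₂ F h k h≤k) (#vanishing h) (q ^ (k ∸ h)) (#admissible h) (q ^ h) (cardD₂-formula h k h≤k 2≤h) (vanishing+admissible h)

    cardD₂-everything : ∀ h k (h≤k : h ≤ k) → 2 ≤ h → #admissible h ≡ 0 → cardD₂ F h k h≤k + 1 ≡ q ^ k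
    cardD₂-everything h k h≤k 2≤h none = begin
      cardD₂ F h k h≤k + 1            ≡⟨ cardD₂-formula h k h≤k 2≤h ⟩
      #vanishing h * q ^ (k ∸ h)      ≡⟨ cong (_* q ^ (k ∸ h)) all-vanish ⟩
      q ^ h * q ^ (k ∸ h)             ≡⟨ ℕP.^-distribˡ-+-* q h (k ∸ h) ⟨
      q ^ (h + (k ∸ h))               ≡⟨ cong (q ^_) (ℕP.m+[n∸m]≡n h≤k) ⟩
      q ^ k                           ∎
      where
      open ≡-Reasoning
      all-vanish : #vanishing h ≡ q ^ h
      all-vanish = trans (sym (ℕP.+-identityʳ _)) (trans (cong (#vanishing h +_) (sym none)) (vanishing+admissible h))

    #admissible-suc : ∀ m → #admissible (suc m) ≡ ∑ᵗ m (λ f → χ (Admissible? f) * (q ∸ #values f))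
    #admissible-suc m = trans (∑ᵗ-suc m (λ f → χ (Admissible? f))) (∑ᵗ-cong m extensions)
      where
      extensions : ∀ f → ∑F (λ a → χ (Admissible? (a ◃ f))) ≡ χ (Admissible? f) * (q ∸ #values f)
      extensions f = begin
        ∑F (λ a → χ (¬? (Occurs? (- a) f) ×-dec Admissible? f))
          ≡⟨ ∑F-cong (λ a → χ-× (¬? (Occurs? (- a) f)) (Admissible? f)) ⟩
        ∑F (λ a → χ (¬? (Occurs? (- a) f)) * χ (Admissible? f))
          ≡⟨ *-distribʳ-sum (χ (Admissible? f)) (λ i → χ (¬? (Occurs? (- e i) f))) ⟨
        ∑F (λ a → χ (¬? (Occurs? (- a) f))) * χ (Admissible? f)
          ≡⟨ cong (_* χ (Admissible? f)) (trans (sym (ℕP.m+n∸n≡m _ (#values f))) (cong (_∸ #values f) (free-choices f))) ⟩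
        (q ∸ #values f) * χ (Admissible? f)
          ≡⟨ ℕP.*-comm (q ∸ #values f) _ ⟩
        χ (Admissible? f) * (q ∸ #values f) ∎
        where open ≡-Reasoning

    -- In characteristic 2, admissible tuples are those with distinct entries.
    char2-#values : Char2 → ∀ {n} (f : Fin n → Carrier) → Admissible f → #values f ≡ n
    char2-#values char2 {zero}  f _             = refl
    char2-#values char2 {suc n} f (¬occ , adm) =
      cong₂ _+_ (cong (_* 1) (χ-yes (¬? (Occurs? (f zero) (f ∘ suc))) (¬occ ∘ Occurs-resp (f ∘ suc) (≈-sym (char2-neg char2 (f zero))))))
                (char2-#values char2 (f ∘ suc) adm)

    #admissible-char2 : Char2 → ∀ m → #admissible m ≡ falling q m
    #admissible-char2 char2 zero    = refl
    #admissible-char2 char2 (suc m) = begin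
      #admissible (suc m)                                  ≡⟨ #admissible-suc m ⟩
      ∑ᵗ m (λ f → χ (Admissible? f) * (q ∸ #values f))     ≡⟨ ∑ᵗ-cong m (λ f → χ-guard (Admissible? f) (cong (q ∸_) ∘ char2-#values char2 f)) ⟩
      ∑ᵗ m (λ f → χ (Admissible? f) * (q ∸ m))             ≡⟨ ∑ᵗ-cong m (λ f → ℕP.*-comm (χ (Admissible? f)) (q ∸ m)) ⟩
      ∑ᵗ m (λ f → (q ∸ m) * χ (Admissible? f))             ≡⟨ ∑ᵗ-*ˡ m (q ∸ m) _ ⟨
      (q ∸ m) * #admissible m                              ≡⟨ ℕP.*-comm (q ∸ m) _ ⟩
      #admissible m * (q ∸ m)                              ≡⟨ cong (_* (q ∸ m)) (#admissible-char2 char2 m) ⟩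
      falling q m * (q ∸ m)                                ∎
      where open ≡-Reasoning

    -- If f has s
    -- distinct nonzero values, the admissible choices of a are
    --   * s "old" values (a ∈ f, necessarily nonzero),
    --   * q ∸ (2s + 1) "new" nonzero values,
    --   * the value 0, if 0 ∉ f.

    -- Pointwise identities between the indicators of N : - a ∈ f,
    -- O : a ∈ f, A : a ≈ 0 and Z : 0 ∈ f, which classify a candidate a.
    module Candidates {N O A : Set} (dN : Dec N) (dO : Dec O) (dA : Dec A) where

      free old new newZero : ℕ
      free    = χ (¬? dN)
      old     = free * χ dO
      new     = free * (χ (¬? dO) * χ (¬? dA))
      newZero = free * (χ (¬? dO) * χ dA)

    module _ {N O A : Set} where
      open Candidates

      classify : (dN : Dec N) (dO : Dec O) (dA : Dec A) → old dN dO dA + (new dN dO dA + newZero dN dO dA) + χ dN ≡ 1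
      classify (yes _) _       _       = refl
      classify (no _)  (yes _) _       = refl
      classify (no _)  (no _)  (yes _) = refl
      classify (no _)  (no _)  (no _)  = refl

      -- a value of f is an old candidate, or it is 0 and then excluded
      occurring : ∀ {Z : Set} (dN : Dec N) (dO : Dec O) (dA : Dec A) (dZ : Dec Z) →
        (N → O → A × Z) → (A → Z → N) → (A → Z → O) → χ dO ≡ old dN dO dA + χ dA * χ dZ
      occurring (yes n) (yes o) dA      dZ      N∧O⇒A∧Z _ _ with N∧O⇒A∧Z n o
      ... | a , z = cong₂ _*_ (sym (χ-yes dA a)) (sym (χ-yes dZ z))
      occurring (yes _) (no ¬o) (yes a) (yes z) _ _ A∧Z⇒O = ⊥-elim (¬o (A∧Z⇒O a z))
      occurring (no ¬n) _       (yes a) (yes z) _ A∧Z⇒N _ = ⊥-elim (¬n (A∧Z⇒N a z))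
      occurring (yes _) (no _)  (yes _) (no _)  _ _ _ = refl
      occurring (yes _) (no _)  (no _)  _       _ _ _ = refl
      occurring (no _)  (yes _) (yes _) (no _)  _ _ _ = refl
      occurring (no _)  (yes _) (no _)  _       _ _ _ = refl
      occurring (no _)  (no _)  (yes _) (no _)  _ _ _ = refl
      occurring (no _)  (no _)  (no _)  _       _ _ _ = refl

      -- The weight of a ◃ f, in terms of whether it contains 0 and of its
      -- number of nonzero values, is determined by the kind of a.
      extension-term : ∀ {Z : Set} (dN : Dec N) (dO : Dec O) (dA : Dec A) (dZ : Dec Z) →
        ∀ (w : Bool → ℕ → ℕ) s → (A → O → Z) →
        free dN dO dA * w (does dA ∨ does dZ) (χ (¬? dO) * χ (¬? dA) + s)
          ≡ old dN dO dA * w (does dZ) s + (new dN dO dA * w (does dZ) (suc s) + newZero dN dO dA * w true s)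
      extension-term (yes _) _       _       _       w s _ = refl
      extension-term (no _)  (yes _) (no _)  _       w s _ = sym (ℕP.+-identityʳ _)
      extension-term (no _)  (no _)  (no _)  _       w s _ = sym (ℕP.+-identityʳ _)
      extension-term (no _)  (no _)  (yes _) _       w s _ = refl
      extension-term (no _)  (yes _) (yes _) (yes _) w s _ = sym (ℕP.+-identityʳ _)
      extension-term (no _)  (yes o) (yes a) (no ¬z) w s A∧O⇒Z = ⊥-elim (¬z (A∧O⇒Z a o))

    admissible-neg : ¬ Char2 → ∀ {n} (f : Fin n → Carrier) → Admissible f → ∀ {a} → Occurs a f → Occurs (- a) f → a ≈ 0#
    admissible-neg ¬char2 {suc n} f (¬occ , adm) {a} (inj₁ f₀≈a) (inj₁ f₀≈-a) =
      odd-neg ¬char2 (≈-trans (≈-sym f₀≈-a) f₀≈a)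
    admissible-neg ¬char2 {suc n} f (¬occ , adm) (inj₁ f₀≈a) (inj₂ occ) =
      ⊥-elim (¬occ (Occurs-resp (f ∘ suc) (-‿cong (≈-sym f₀≈a)) occ))
    admissible-neg ¬char2 {suc n} f (¬occ , adm) {a} (inj₂ occ) (inj₁ f₀≈-a) =
      ⊥-elim (¬occ (Occurs-resp (f ∘ suc) (≈-trans (≈-sym (-‿involutive a)) (-‿cong (≈-sym f₀≈-a))) occ))
    admissible-neg ¬char2 {suc n} f (¬occ , adm) (inj₂ occ) (inj₂ occ′) =
      admissible-neg ¬char2 (f ∘ suc) adm occ occ′

    hasZero : ∀ {n} → (Fin n → Carrier) → Bool
    hasZero f = does (Occurs? 0# f)

    φ : ℕ → ℕ
    φ s = q ∸ (2 * s + 1)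

    module Extension (¬char2 : ¬ Char2) {n} (f : Fin n → Carrier) (adm : Admissible f) where

      free old new newZero : Carrier → ℕ
      free    a = Candidates.free    (Occurs? (- a) f) (Occurs? a f) (a ≟ 0#)
      old     a = Candidates.old     (Occurs? (- a) f) (Occurs? a f) (a ≟ 0#)
      new     a = Candidates.new     (Occurs? (- a) f) (Occurs? a f) (a ≟ 0#)
      newZero a = Candidates.newZero (Occurs? (- a) f) (Occurs? a f) (a ≟ 0#)

      s z : ℕ
      s = #nonzero f
      z = χ (Occurs? 0# f)

      #values-nonzero : #values f ≡ s + z
      #values-nonzero = begin
        #values f                                      ≡⟨ ∑-occurring f ⟨
        ∑F (λ a → χ (Occurs? a f))                     ≡⟨ ∑F-cong nonzero-split ⟩
        ∑F (λ a → χ (Occurs? a f) * χ (¬? (a ≟ 0#)) + χ (a ≟ 0#) * χ (Occurs? a f))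
          ≡⟨ ∑-distrib-+ (λ i → χ (Occurs? (e i) f) * χ (¬? (e i ≟ 0#))) _ ⟩
        ∑F (λ a → χ (Occurs? a f) * χ (¬? (a ≟ 0#))) + ∑F (λ a → χ (a ≟ 0#) * χ (Occurs? a f))
          ≡⟨ cong₂ _+_ (∑-over-occurring _ nonzero-resp f) (∑F-pick 0# _ (χ-Occurs-resp f)) ⟩
        s + z                                          ∎
        where
        open ≡-Reasoning
        nonzero-split : ∀ a → χ (Occurs? a f) ≡ χ (Occurs? a f) * χ (¬? (a ≟ 0#)) + χ (a ≟ 0#) * χ (Occurs? a f)
        nonzero-split a with Occurs? a f | a ≟ 0#
        ... | yes _ | yes _ = refl
        ... | yes _ | no _  = refl
        ... | no _  | yes _ = refl
        ... | no _  | no _  = refl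
        nonzero-resp : Respects≈ (λ a → χ (¬? (a ≟ 0#)))
        nonzero-resp a≈b = χ-cong (¬? (_ ≟ 0#)) (¬? (_ ≟ 0#))
          (λ a≉0 b≈0 → a≉0 (≈-trans a≈b b≈0)) (λ b≉0 a≈0 → b≉0 (≈-trans (≈-sym a≈b) a≈0))

      #values-old : #values f ≡ ∑F old + z
      #values-old = begin
        #values f                                      ≡⟨ ∑-occurring f ⟨
        ∑F (λ a → χ (Occurs? a f))                     ≡⟨ ∑F-cong (λ a → occurring (Occurs? (- a) f) (Occurs? a f) (a ≟ 0#) (Occurs? 0# f)
                                                                       (N∧O⇒A∧Z a) A∧Z⇒N (A∧Z⇒O a)) ⟩
        ∑F (λ a → old a + χ (a ≟ 0#) * z)              ≡⟨ ∑-distrib-+ (old ∘ e) _ ⟩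
        ∑F old + ∑F (λ a → χ (a ≟ 0#) * z)             ≡⟨ cong (∑F old +_) (∑F-pick 0# (λ _ → z) (λ _ → refl)) ⟩
        ∑F old + z                                     ∎
        where
        open ≡-Reasoning
        N∧O⇒A∧Z : ∀ a → Occurs (- a) f → Occurs a f → a ≈ 0# × Occurs 0# f
        N∧O⇒A∧Z a n o = let a≈0 = admissible-neg ¬char2 f adm o n in a≈0 , Occurs-resp f a≈0 o
        A∧Z⇒N : ∀ {a} → a ≈ 0# → Occurs 0# f → Occurs (- a) f
        A∧Z⇒N a≈0 = Occurs-resp f (≈-trans (≈-sym -0#≈0#) (-‿cong (≈-sym a≈0)))
        A∧Z⇒O : ∀ a → a ≈ 0# → Occurs 0# f → Occurs a f
        A∧Z⇒O a a≈0 = Occurs-resp f (≈-sym a≈0)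

      #old : ∑F old ≡ s
      #old = ℕP.+-cancelʳ-≡ z _ _ (trans (sym #values-old) #values-nonzero)

      #newZero : ∑F newZero ≡ χ (¬? (Occurs? 0# f))
      #newZero = begin
        ∑F newZero                                                ≡⟨ ∑F-cong (λ a → regroup (free a) (χ (¬? (Occurs? a f))) (χ (a ≟ 0#))) ⟩
        ∑F (λ a → χ (a ≟ 0#) * (free a * χ (¬? (Occurs? a f))))   ≡⟨ ∑F-pick 0# _ resp ⟩
        χ (¬? (Occurs? (- 0#) f)) * χ (¬? (Occurs? 0# f))         ≡⟨ cong (_* χ (¬? (Occurs? 0# f))) (χ-¬Occurs-resp f -0#≈0#) ⟩
        χ (¬? (Occurs? 0# f)) * χ (¬? (Occurs? 0# f))             ≡⟨ χ-idem (¬? (Occurs? 0# f)) ⟩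
        χ (¬? (Occurs? 0# f))                                     ∎
        where
        open ≡-Reasoning
        regroup : ∀ x y z → x * (y * z) ≡ z * (x * y)
        regroup = solve-∀
        resp : Respects≈ (λ a → free a * χ (¬? (Occurs? a f)))
        resp a≈b = cong₂ _*_ (χ-¬Occurs-resp f (-‿cong a≈b)) (χ-¬Occurs-resp f a≈b)

      all-candidates : ∑F old + (∑F new + ∑F newZero) + #values f ≡ q
      all-candidates = begin
        ∑F old + (∑F new + ∑F newZero) + #values f
          ≡⟨ cong (∑F old + (∑F new + ∑F newZero) +_) (∑-occurring-neg f) ⟨
        ∑F old + (∑F new + ∑F newZero) + ∑F (λ a → χ (Occurs? (- a) f))
          ≡⟨ cong (λ x → ∑F old + x + ∑F (λ a → χ (Occurs? (- a) f))) (∑-distrib-+ (new ∘ e) (newZero ∘ e)) ⟨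
        ∑F old + ∑F (λ a → new a + newZero a) + ∑F (λ a → χ (Occurs? (- a) f))
          ≡⟨ cong (_+ ∑F (λ a → χ (Occurs? (- a) f))) (∑-distrib-+ (old ∘ e) (λ i → new (e i) + newZero (e i))) ⟨
        ∑F (λ a → old a + (new a + newZero a)) + ∑F (λ a → χ (Occurs? (- a) f))
          ≡⟨ ∑-distrib-+ (λ i → old (e i) + (new (e i) + newZero (e i))) _ ⟨
        ∑F (λ a → old a + (new a + newZero a) + χ (Occurs? (- a) f))
          ≡⟨ trans (∑F-cong (λ a → classify (Occurs? (- a) f) (Occurs? a f) (a ≟ 0#))) ∑F-one ⟩
        q ∎
        where open ≡-Reasoning

      #new : ∑F new ≡ φ s
      #new = trans (sym (ℕP.m+n∸n≡m (∑F new) (2 * s + 1))) (cong (_∸ (2 * s + 1)) (begin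
        ∑F new + (2 * s + 1)
          ≡⟨ cong (λ x → ∑F new + (2 * s + x)) (χ-¬ (Occurs? 0# f)) ⟨
        ∑F new + (2 * s + (χ (¬? (Occurs? 0# f)) + z))
          ≡⟨ regroup (∑F new) s (χ (¬? (Occurs? 0# f))) z ⟩
        s + (∑F new + χ (¬? (Occurs? 0# f))) + (s + z)
          ≡⟨ cong₂ (λ x y → x + (∑F new + y) + (s + z)) #old #newZero ⟨
        ∑F old + (∑F new + ∑F newZero) + (s + z)
          ≡⟨ cong (∑F old + (∑F new + ∑F newZero) +_) #values-nonzero ⟨
        ∑F old + (∑F new + ∑F newZero) + #values f
          ≡⟨ all-candidates ⟩
        q ∎))
        where
        open ≡-Reasoning
        regroup : ∀ x s c z → x + (2 * s + (c + z)) ≡ s + (x + c) + (s + z)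
        regroup = solve-∀

      extension-sum : ∀ (w : Bool → ℕ → ℕ) →
        ∑F (λ a → free a * w (hasZero (a ◃ f)) (#nonzero (a ◃ f)))
          ≡ s * w (hasZero f) s + (φ s * w (hasZero f) (suc s) + χ (¬? (Occurs? 0# f)) * w true s)
      extension-sum w = begin
        ∑F (λ a → free a * w (hasZero (a ◃ f)) (#nonzero (a ◃ f)))
          ≡⟨ ∑F-cong (λ a → extension-term (Occurs? (- a) f) (Occurs? a f) (a ≟ 0#) (Occurs? 0# f) w s
                                            (λ a≈0 o → Occurs-resp f a≈0 o)) ⟩
        ∑F (λ a → old a * W₁ + (new a * W₂ + newZero a * W₃))
          ≡⟨ ∑-distrib-+ (λ i → old (e i) * W₁) _ ⟩
        ∑F (λ a → old a * W₁) + ∑F (λ a → new a * W₂ + newZero a * W₃)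
          ≡⟨ cong₂ _+_ (sym (*-distribʳ-sum W₁ (old ∘ e))) (∑-linear q (new ∘ e) (newZero ∘ e) W₂ W₃) ⟩
        ∑F old * W₁ + (∑F new * W₂ + ∑F newZero * W₃)
          ≡⟨ cong₂ (λ x y → x * W₁ + y) #old (cong₂ (λ x y → x * W₂ + y * W₃) #new #newZero) ⟩
        s * W₁ + (φ s * W₂ + χ (¬? (Occurs? 0# f)) * W₃) ∎
        where
        open ≡-Reasoning
        W₁ W₂ W₃ : ℕ
        W₁ = w (hasZero f) s
        W₂ = w (hasZero f) (suc s)
        W₃ = w true s

    -- Odd characteristic: admissible tuples counted by whether they
    -- contain 0 (b = true or false) and by their number t of nonzero values.

    level : Bool → ℕ → Bool → ℕ → ℕ
    level b t b′ t′ = χ (b′ Bool.≟ b) * χ (t′ ℕ.≟ t)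

    #admissibleAt : Bool → ℕ → ℕ → ℕ
    #admissibleAt b n t = ∑ᵗ n (λ f → χ (Admissible? f) * level b t (hasZero f) (#nonzero f))

    -- How the counts by number of nonzero values change when a new entry
    -- is added: an old value keeps t, one of q ∸ (2t + 1) new ones raises it.
    step : (ℕ → ℕ) → ℕ → ℕ
    step g zero    = 0
    step g (suc t) = suc t * g (suc t) + φ t * g t

    step-cong : ∀ {g g′ : ℕ → ℕ} → (∀ t → g t ≡ g′ t) → ∀ t → step g t ≡ step g′ t
    step-cong g≗g′ zero    = refl
    step-cong g≗g′ (suc t) = cong₂ (λ x y → suc t * x + φ t * y) (g≗g′ (suc t)) (g≗g′ t)

    step-scale : ∀ c g t → step (λ t → c * g t) t ≡ c * step g t
    step-scale c g zero    = sym (ℕP.*-zeroʳ c)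
    step-scale c g (suc t) = distribute (suc t) (φ t) c (g (suc t)) (g t)
      where
      distribute : ∀ a b c x y → a * (c * x) + b * (c * y) ≡ c * (a * x + b * y)
      distribute = solve-∀

    ∑ᵗ-step : ∀ m (c : (Fin m → Carrier) → ℕ) (g : (Fin m → Carrier) → ℕ → ℕ) t →
      ∑ᵗ m (λ f → c f * step (g f) t) ≡ step (λ t → ∑ᵗ m (λ f → c f * g f t)) t
    ∑ᵗ-step m c g zero    = trans (∑ᵗ-cong m (λ f → ℕP.*-zeroʳ (c f))) (∑ᵗ-zero m)
    ∑ᵗ-step m c g (suc t) = begin
      ∑ᵗ m (λ f → c f * (suc t * g f (suc t) + φ t * g f t))
        ≡⟨ ∑ᵗ-cong m (λ f → distribute (c f) (suc t) (φ t) (g f (suc t)) (g f t)) ⟩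
      ∑ᵗ m (λ f → suc t * (c f * g f (suc t)) + φ t * (c f * g f t))
        ≡⟨ ∑ᵗ-distrib-+ m _ _ ⟩
      ∑ᵗ m (λ f → suc t * (c f * g f (suc t))) + ∑ᵗ m (λ f → φ t * (c f * g f t))
        ≡⟨ cong₂ _+_ (∑ᵗ-*ˡ m (suc t) _) (∑ᵗ-*ˡ m (φ t) _) ⟨
      suc t * ∑ᵗ m (λ f → c f * g f (suc t)) + φ t * ∑ᵗ m (λ f → c f * g f t) ∎
      where
      open ≡-Reasoning
      distribute : ∀ c a b x y → c * (a * x + b * y) ≡ a * (c * x) + b * (c * y)
      distribute = solve-∀

    at-level : ∀ (h : ℕ → ℕ) c s t → h s * (c * χ (s ℕ.≟ t)) ≡ h t * (c * χ (s ℕ.≟ t))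
    at-level h c s t with s ℕ.≟ t
    ... | yes refl = refl
    ... | no _     = trans (cong (h s *_) (ℕP.*-zeroʳ c)) (trans (ℕP.*-zeroʳ (h s)) (sym (trans (cong (h t *_) (ℕP.*-zeroʳ c)) (ℕP.*-zeroʳ (h t)))))

    level-transition : ∀ b t z s → s * level b t z s + φ s * level b t z (suc s) ≡ step (λ t → level b t z s) t
    level-transition b zero    z s = cong₂ _+_ (at-level (λ x → x) (χ (z Bool.≟ b)) s 0)
                                               (trans (cong (φ s *_) (ℕP.*-zeroʳ (χ (z Bool.≟ b)))) (ℕP.*-zeroʳ (φ s)))
    level-transition b (suc t) z s = cong₂ _+_ (at-level (λ x → x) (χ (z Bool.≟ b)) s (suc t))
      (trans (cong (λ x → φ s * (χ (z Bool.≟ b) * x)) (χ-cong (suc s ℕ.≟ suc t) (s ℕ.≟ t) ℕP.suc-injective (cong suc)))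
             (at-level φ (χ (z Bool.≟ b)) s t))

    module _ (¬char2 : ¬ Char2) where

      #admissibleAt-suc : ∀ b m t → #admissibleAt b (suc m) t
        ≡ step (#admissibleAt b m) t + ∑ᵗ m (λ f → χ (Admissible? f) * (χ (¬? (Occurs? 0# f)) * level b t true (#nonzero f)))
      #admissibleAt-suc b m t = begin
        #admissibleAt b (suc m) t
          ≡⟨ ∑ᵗ-suc m (λ f → χ (Admissible? f) * L f) ⟩
        ∑ᵗ m (λ f → ∑F (λ a → χ (Admissible? (a ◃ f)) * L (a ◃ f)))
          ≡⟨ ∑ᵗ-cong m extend ⟩
        ∑ᵗ m (λ f → χ (Admissible? f) * step (λ t → level b t (hasZero f) (#nonzero f)) t + χ (Admissible? f) * zeroAdded f)
          ≡⟨ ∑ᵗ-distrib-+ m _ _ ⟩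
        ∑ᵗ m (λ f → χ (Admissible? f) * step (λ t → level b t (hasZero f) (#nonzero f)) t) + ∑ᵗ m (λ f → χ (Admissible? f) * zeroAdded f)
          ≡⟨ cong (_+ ∑ᵗ m (λ f → χ (Admissible? f) * zeroAdded f))
                  (∑ᵗ-step m (λ f → χ (Admissible? f)) (λ f t → level b t (hasZero f) (#nonzero f)) t) ⟩
        step (#admissibleAt b m) t + ∑ᵗ m (λ f → χ (Admissible? f) * zeroAdded f) ∎
        where
        open ≡-Reasoning
        L : ∀ {n} → (Fin n → Carrier) → ℕ
        L f = level b t (hasZero f) (#nonzero f)
        zeroAdded : (Fin m → Carrier) → ℕ
        zeroAdded f = χ (¬? (Occurs? 0# f)) * level b t true (#nonzero f)
        extend : ∀ f → ∑F (λ a → χ (Admissible? (a ◃ f)) * L (a ◃ f))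
          ≡ χ (Admissible? f) * step (λ t → level b t (hasZero f) (#nonzero f)) t + χ (Admissible? f) * zeroAdded f
        extend f = begin
          ∑F (λ a → χ (Admissible? (a ◃ f)) * L (a ◃ f))
            ≡⟨ ∑F-cong (λ a → trans (cong (_* L (a ◃ f)) (χ-× (¬? (Occurs? (- a) f)) (Admissible? f)))
                                    (regroup (χ (¬? (Occurs? (- a) f))) (χ (Admissible? f)) (L (a ◃ f)))) ⟩
          ∑F (λ a → χ (Admissible? f) * (χ (¬? (Occurs? (- a) f)) * L (a ◃ f)))
            ≡⟨ *-distribˡ-sum (χ (Admissible? f)) (λ i → χ (¬? (Occurs? (- e i) f)) * L (e i ◃ f)) ⟨
          χ (Admissible? f) * ∑F (λ a → χ (¬? (Occurs? (- a) f)) * L (a ◃ f))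
            ≡⟨ χ-guard (Admissible? f) (λ adm → Extension.extension-sum ¬char2 f adm (level b t)) ⟩
          χ (Admissible? f) * (#nonzero f * L f + (φ (#nonzero f) * level b t (hasZero f) (suc (#nonzero f)) + zeroAdded f))
            ≡⟨ cong (χ (Admissible? f) *_) (trans (sym (ℕP.+-assoc (#nonzero f * L f) _ (zeroAdded f)))
                                                  (cong (_+ zeroAdded f) (level-transition b t (hasZero f) (#nonzero f)))) ⟩
          χ (Admissible? f) * (step (λ t → level b t (hasZero f) (#nonzero f)) t + zeroAdded f)
            ≡⟨ ℕP.*-distribˡ-+ (χ (Admissible? f)) _ _ ⟩
          χ (Admissible? f) * step (λ t → level b t (hasZero f) (#nonzero f)) t + χ (Admissible? f) * zeroAdded f ∎
          where
          regroup : ∀ x y z → x * y * z ≡ y * (x * z)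
          regroup = solve-∀

      #zeroFree-suc : ∀ m t → #admissibleAt false (suc m) t ≡ step (#admissibleAt false m) t
      #zeroFree-suc m t = begin
        #admissibleAt false (suc m) t
          ≡⟨ #admissibleAt-suc false m t ⟩
        step (#admissibleAt false m) t + ∑ᵗ m (λ f → χ (Admissible? f) * (χ (¬? (Occurs? 0# f)) * 0))
          ≡⟨ cong (step (#admissibleAt false m) t +_) (trans (∑ᵗ-cong m (λ f → vanish (χ (Admissible? f)) (χ (¬? (Occurs? 0# f))))) (∑ᵗ-zero m)) ⟩
        step (#admissibleAt false m) t + 0
          ≡⟨ ℕP.+-identityʳ _ ⟩
        step (#admissibleAt false m) t ∎
        where
        open ≡-Reasoning
        vanish : ∀ x y → x * (y * 0) ≡ 0
        vanish = solve-∀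

      #withZero-suc : ∀ m t → #admissibleAt true (suc m) t ≡ step (#admissibleAt true m) t + #admissibleAt false m t
      #withZero-suc m t = trans (#admissibleAt-suc true m t)
        (cong (step (#admissibleAt true m) t +_) (∑ᵗ-cong m (λ f → cong (χ (Admissible? f) *_) (zero-added f))))
        where
        zero-added : ∀ (f : Fin m → Carrier) → χ (¬? (Occurs? 0# f)) * level true t true (#nonzero f) ≡ level false t (hasZero f) (#nonzero f)
        zero-added f with Occurs? 0# f
        ... | yes _ = refl
        ... | no _  = ℕP.+-identityʳ _

      -- Admissible tuples with a 0: the 0 sits in one of m + 1 positions.
      #withZero : ∀ m t → #admissibleAt true (suc m) t ≡ suc m * #admissibleAt false m t
      #withZero zero t = begin
        #admissibleAt true 1 t                      ≡⟨ #withZero-suc 0 t ⟩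
        step (λ _ → 0) t + #admissibleAt false 0 t  ≡⟨ cong (_+ #admissibleAt false 0 t) (step-scale 0 (λ _ → 0) t) ⟩
        #admissibleAt false 0 t                     ≡⟨ ℕP.*-identityˡ _ ⟨
        1 * #admissibleAt false 0 t                 ∎
        where open ≡-Reasoning
      #withZero (suc m) t = begin
        #admissibleAt true (suc (suc m)) t
          ≡⟨ #withZero-suc (suc m) t ⟩
        step (#admissibleAt true (suc m)) t + #admissibleAt false (suc m) t
          ≡⟨ cong (_+ #admissibleAt false (suc m) t) (trans (step-cong (#withZero m) t) (step-scale (suc m) _ t)) ⟩
        suc m * step (#admissibleAt false m) t + #admissibleAt false (suc m) t
          ≡⟨ cong (λ x → suc m * x + #admissibleAt false (suc m) t) (#zeroFree-suc m t) ⟨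
        suc m * #admissibleAt false (suc m) t + #admissibleAt false (suc m) t
          ≡⟨ ℕP.+-comm (suc m * #admissibleAt false (suc m) t) _ ⟩
        suc (suc m) * #admissibleAt false (suc m) t ∎
        where open ≡-Reasoning

      -- Zero-free admissible tuples with t nonzero values: choose the t
      -- values, one from each of t of the (q - 1)/2 pairs {a, - a}, and a
      -- surjection onto them.
      #zeroFree : ∀ m t → #admissibleAt false m t * t ! ≡ oddFalling q t * 𝒮 m t
      #zeroFree zero    zero    = refl
      #zeroFree zero    (suc t) = sym (ℕP.*-zeroʳ (oddFalling q (suc t)))
      #zeroFree (suc m) zero    = cong (_* 1) (#zeroFree-suc m 0)
      #zeroFree (suc m) (suc t) = begin
        #admissibleAt false (suc m) (suc t) * suc t !
          ≡⟨ cong (_* suc t !) (#zeroFree-suc m (suc t)) ⟩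
        (suc t * A + φ t * B) * (suc t * t !)
          ≡⟨ regroup (suc t) A (φ t) B (t !) ⟩
        suc t * (A * suc t !) + φ t * suc t * (B * t !)
          ≡⟨ cong₂ (λ x y → suc t * x + φ t * suc t * y) (#zeroFree m (suc t)) (#zeroFree m t) ⟩
        suc t * (oddFalling q t * φ t * 𝒮 m (suc t)) + φ t * suc t * (oddFalling q t * 𝒮 m t)
          ≡⟨ collect (suc t) (oddFalling q t) (φ t) (𝒮 m (suc t)) (𝒮 m t) ⟩
        oddFalling q t * φ t * (suc t * (𝒮 m (suc t) + 𝒮 m t))
          ≡⟨ cong (oddFalling q (suc t) *_) (𝒮-suc m t) ⟨
        oddFalling q (suc t) * 𝒮 (suc m) (suc t) ∎
        where
        open ≡-Reasoning
        A B : ℕ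
        A = #admissibleAt false m (suc t)
        B = #admissibleAt false m t
        regroup : ∀ u a p b f → (u * a + p * b) * (u * f) ≡ u * (a * (u * f)) + p * u * (b * f)
        regroup = solve-∀
        collect : ∀ u o p x y → u * (o * p * x) + p * u * (o * y) ≡ o * p * (u * (x + y))
        collect = solve-∀

    levels-partition : ∀ z s B → s ≤ B →
      (level false 0 z s + ∑₁ B (λ t → level false t z s)) + (level true 0 z s + ∑₁ B (λ t → level true t z s)) ≡ 1
    levels-partition z s B s≤B = trans (cong₂ _+_ (group false) (group true)) (by-status z)
      where
      group : ∀ b → level b 0 z s + ∑₁ B (λ t → level b t z s) ≡ χ (z Bool.≟ b) * 1
      group b = begin
        level b 0 z s + ∑₁ B (λ t → level b t z s)
          ≡⟨ cong (level b 0 z s +_) (∑₁-*ˡ B (χ (z Bool.≟ b)) (λ t → χ (s ℕ.≟ t))) ⟨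
        χ (z Bool.≟ b) * χ (s ℕ.≟ 0) + χ (z Bool.≟ b) * ∑₁ B (λ t → χ (s ℕ.≟ t))
          ≡⟨ ℕP.*-distribˡ-+ (χ (z Bool.≟ b)) _ _ ⟨
        χ (z Bool.≟ b) * (χ (s ℕ.≟ 0) + ∑₁ B (λ t → χ (s ℕ.≟ t)))
          ≡⟨ cong (χ (z Bool.≟ b) *_) (∑₁-indicator B s≤B) ⟩
        χ (z Bool.≟ b) * 1 ∎
        where open ≡-Reasoning
      by-status : ∀ z → χ (z Bool.≟ false) * 1 + χ (z Bool.≟ true) * 1 ≡ 1
      by-status false = refl
      by-status true  = refl

    #admissible-split : ∀ n B → n ≤ B → #admissible n
      ≡ (#admissibleAt false n 0 + ∑₁ B (#admissibleAt false n)) + (#admissibleAt true n 0 + ∑₁ B (#admissibleAt true n))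
    #admissible-split n B n≤B = begin
      ∑ᵗ n (λ f → χ (Admissible? f))
        ≡⟨ ∑ᵗ-cong n (λ f → trans (sym (ℕP.*-identityʳ (χ (Admissible? f))))
                                   (cong (χ (Admissible? f) *_) (sym (levels-partition (hasZero f) (#nonzero f) B (bound f))))) ⟩
      ∑ᵗ n (λ f → χ (Admissible? f) * ((L false 0 f + ∑₁ B (λ t → L false t f)) + (L true 0 f + ∑₁ B (λ t → L true t f))))
        ≡⟨ ∑ᵗ-cong n (λ f → trans (ℕP.*-distribˡ-+ (χ (Admissible? f)) _ _) (cong₂ _+_ (spread f false) (spread f true))) ⟩
      ∑ᵗ n (λ f → (T false 0 f + ∑₁ B (λ t → T false t f)) + (T true 0 f + ∑₁ B (λ t → T true t f)))
        ≡⟨ ∑ᵗ-distrib-+ n _ _ ⟩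
      ∑ᵗ n (λ f → T false 0 f + ∑₁ B (λ t → T false t f)) + ∑ᵗ n (λ f → T true 0 f + ∑₁ B (λ t → T true t f))
        ≡⟨ cong₂ _+_ (by-level false) (by-level true) ⟩
      (#admissibleAt false n 0 + ∑₁ B (#admissibleAt false n)) + (#admissibleAt true n 0 + ∑₁ B (#admissibleAt true n)) ∎
      where
      open ≡-Reasoning
      L T : Bool → ℕ → (Fin n → Carrier) → ℕ
      L b t f = level b t (hasZero f) (#nonzero f)
      T b t f = χ (Admissible? f) * L b t f
      bound : ∀ f → #nonzero f ≤ B
      bound f = ℕP.≤-trans (overValues-≤ _ (λ a → χ≤1 (¬? (a ≟ 0#))) f) n≤B
      spread : ∀ f b → χ (Admissible? f) * (L b 0 f + ∑₁ B (λ t → L b t f)) ≡ T b 0 f + ∑₁ B (λ t → T b t f)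
      spread f b = trans (ℕP.*-distribˡ-+ (χ (Admissible? f)) _ _) (cong (T b 0 f +_) (∑₁-*ˡ B (χ (Admissible? f)) (λ t → L b t f)))
      by-level : ∀ b → ∑ᵗ n (λ f → T b 0 f + ∑₁ B (λ t → T b t f)) ≡ #admissibleAt b n 0 + ∑₁ B (#admissibleAt b n)
      by-level b = trans (∑ᵗ-distrib-+ n _ _) (cong (#admissibleAt b n 0 +_) (∑ᵗ-∑₁ n B (λ t f → T b t f)))

    -- A tuple of length n has at most n nonzero values.
    #admissibleAt-beyond-length : ∀ b n t → n < t → #admissibleAt b n t ≡ 0
    #admissibleAt-beyond-length b n t n<t = trans (∑ᵗ-cong n vanish) (∑ᵗ-zero n)
      where
      vanish : ∀ f → χ (Admissible? f) * level b t (hasZero f) (#nonzero f) ≡ 0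
      vanish f = trans (cong (λ x → χ (Admissible? f) * (χ (hasZero f Bool.≟ b) * x))
                             (χ-no (#nonzero f ℕ.≟ t) (λ eq → ℕP.<⇒≢ (ℕP.≤-<-trans (overValues-≤ _ (λ a → χ≤1 (¬? (a ≟ 0#))) f) n<t) eq)))
                       (trans (cong (χ (Admissible? f) *_) (ℕP.*-zeroʳ (χ (hasZero f Bool.≟ b)))) (ℕP.*-zeroʳ (χ (Admissible? f))))

    module OddTotals (¬char2 : ¬ Char2) (X : ℕ) (q≡2X+1 : q ≡ suc (2 * X)) where

      #zeroFree-beyond-half : ∀ n t → X < t → #admissibleAt false n t ≡ 0
      #zeroFree-beyond-half n t X<t = ℕP.m*n≡0⇒m≡0 _ (t !) {{t !≢0}}
        (trans (#zeroFree ¬char2 n t) (trans (cong (λ x → oddFalling x t * 𝒮 n t) q≡2X+1) (cong (_* 𝒮 n t) (oddFalling-vanishes X t X<t))))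

      Γ-count : ∀ n B → n ≤ B → ℕ→ℚ (∑₁ B (#admissibleAt false n)) ≡ Γ n q
      Γ-count n B n≤B = begin
        ℕ→ℚ (∑₁ B N)             ≡⟨ cong ℕ→ℚ (∑₁-truncate B n N (#admissibleAt-beyond-length false n)) ⟩
        ℕ→ℚ (∑₁ (B ⊓ n) N)       ≡⟨ cong (λ m → ℕ→ℚ (∑₁ m N)) (ℕP.m≥n⇒m⊓n≡n n≤B) ⟩
        ℕ→ℚ (∑₁ n N)             ≡⟨ cong ℕ→ℚ (∑₁-truncate n X N (#zeroFree-beyond-half n)) ⟩
        ℕ→ℚ (∑₁ (n ⊓ X) N)       ≡⟨ ℕ→ℚ-∑₁ (n ⊓ X) N ⟩
        sum1 (n ⊓ X) (ℕ→ℚ ∘ N)   ≡⟨ sum1-cong (n ⊓ X) (λ t → sym (ℕ→ℚ-/ (oddFalling q t) (t !) (N t) (𝒮 n t) {{t !≢0}} (#zeroFree ¬char2 n t))) ⟩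
        sum1 (n ⊓ X) (λ t → ((ℤ.+ oddFalling q t) ℚ./ (t !)) {{t !≢0}} ℚ.* ℕ→ℚ (𝒮 n t))
                                 ≡⟨ cong (λ Y → sum1 (n ⊓ Y) (λ t → ((ℤ.+ oddFalling q t) ℚ./ (t !)) {{t !≢0}} ℚ.* ℕ→ℚ (𝒮 n t))) half ⟨
        Γ n q                    ∎
        where
        open ≡-Reasoning
        N : ℕ → ℕ
        N = #admissibleAt false n
        half : (q ∸ 1) / 2 ≡ X
        half = trans (cong (λ x → (x ∸ 1) / 2) q≡2X+1) (trans (cong (_/ 2) (ℕP.*-comm 2 X)) (m*n/n≡m X 2))

      -- Admissible tuples of length m + 2: the zero-free ones, and those
      -- with a 0 in one of m + 2 positions next to a zero-free tuple.
      #admissible-by-zero : ∀ m → #admissible (suc (suc m))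
        ≡ ∑₁ (suc (suc m)) (#admissibleAt false (suc (suc m))) + suc (suc m) * ∑₁ (suc (suc m)) (#admissibleAt false (suc m))
      #admissible-by-zero m = begin
        #admissible (suc (suc m))
          ≡⟨ #admissible-split (suc (suc m)) B ℕP.≤-refl ⟩
        (N′ 0 + ∑₁ B N′) + (#admissibleAt true (suc (suc m)) 0 + ∑₁ B (#admissibleAt true (suc (suc m))))
          ≡⟨ cong₂ _+_ (cong (_+ ∑₁ B N′) (#zeroFree-suc ¬char2 (suc m) 0))
                       (cong₂ _+_ (trans (#withZero ¬char2 (suc m) 0) (cong (B *_) (#zeroFree-suc ¬char2 m 0)))
                                  (trans (∑₁-cong B (#withZero ¬char2 (suc m))) (sym (∑₁-*ˡ B B N)))) ⟩
        ∑₁ B N′ + (B * 0 + B * ∑₁ B N)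
          ≡⟨ cong (λ x → ∑₁ B N′ + (x + B * ∑₁ B N)) (ℕP.*-zeroʳ B) ⟩
        ∑₁ B N′ + B * ∑₁ B N ∎
        where
        open ≡-Reasoning
        B : ℕ
        B = suc (suc m)
        N N′ : ℕ → ℕ
        N  = #admissibleAt false (suc m)
        N′ = #admissibleAt false (suc (suc m))

      #admissible-odd : ∀ m → ℕ→ℚ (#admissible (suc (suc m))) ≡ Γ (suc (suc m)) q ℚ.+ ℕ→ℚ (suc (suc m)) ℚ.* Γ (suc m) q
      #admissible-odd m = begin
        ℕ→ℚ (#admissible B)
          ≡⟨ cong ℕ→ℚ (#admissible-by-zero m) ⟩
        ℕ→ℚ (∑₁ B (N B) + B * ∑₁ B (N (suc m)))
          ≡⟨ trans (ℕ→ℚ-+ (∑₁ B (N B)) (B * ∑₁ B (N (suc m)))) (cong (ℕ→ℚ (∑₁ B (N B)) ℚ.+_) (ℕ→ℚ-* B (∑₁ B (N (suc m))))) ⟩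
        ℕ→ℚ (∑₁ B (N B)) ℚ.+ ℕ→ℚ B ℚ.* ℕ→ℚ (∑₁ B (N (suc m)))
          ≡⟨ cong₂ (λ x y → x ℚ.+ ℕ→ℚ B ℚ.* y) (Γ-count B B ℕP.≤-refl) (Γ-count (suc m) B (ℕP.n≤1+n _)) ⟩
        Γ B q ℚ.+ ℕ→ℚ B ℚ.* Γ (suc m) q ∎
        where
        open ≡-Reasoning
        B : ℕ
        B = suc (suc m)
        N : ℕ → ℕ → ℕ
        N = #admissibleAt false

open import Defs
open import Data.Nat using (ℕ; suc; z≤n; s≤s; _≤_; _<_; _^_; _∸_)
open import Data.Nat.Primality using (Prime)
open import Data.Product using (_×_; _,_)
open import Relation.Binary.PropositionalEquality using (_≡_; trans; cong; subst)
open import Relation.Nullary using (¬_)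
open import Data.Rational using (_-_; _*_; 1ℚ)
open Counting

proposition9 : (F : FiniteField) (p e h k : ℕ) → Prime p
    → FiniteField.size F ≡ p ^ e → 3 ≤ h → (h≤k : h ≤ k)
    → let q = FiniteField.size F in
      (p ≡ 2 → h ≤ q → ℕ→ℚ (cardD₂ F h k h≤k)
          ≡ ℕ→ℚ (q ^ (k ∸ h)) * (ℕ→ℚ (q ^ h) - ℕ→ℚ (falling q h)) - 1ℚ)
      × (p ≡ 2 → q < h → ℕ→ℚ (cardD₂ F h k h≤k) ≡ ℕ→ℚ (q ^ k) - 1ℚ)
      × (2 < p → ℕ→ℚ (cardD₂ F h k h≤k)
          ≡ ℕ→ℚ (q ^ (k ∸ h)) * (ℕ→ℚ (q ^ h) - Γ h q - ℕ→ℚ h * Γ (h ∸ 1) q) - 1ℚ)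
proposition9 F p n (suc (suc m)) k p-prime q≡pⁿ (s≤s (s≤s _)) h≤k =
    (λ p≡2 _ → trans (cardD₂-via-admissible h k h≤k 2≤h)
                      (cong (λ a → ℕ→ℚ (q ^ (k ∸ h)) * (ℕ→ℚ (q ^ h) - ℕ→ℚ a) - 1ℚ) (#admissible-char2 (char2 p≡2) h)))
  , (λ p≡2 q<h → ℕ→ℚ-pred (cardD₂ F h k h≤k) (q ^ k)
                   (cardD₂-everything h k h≤k 2≤h (trans (#admissible-char2 (char2 p≡2) h) (falling-vanishes q h q<h))))
  , (λ 2<p → let X , q≡2X+1 = q-odd (¬char2 2<p) in
       trans (cardD₂-via-admissible h k h≤k 2≤h)
         (trans (cong (λ a → ℕ→ℚ (q ^ (k ∸ h)) * (ℕ→ℚ (q ^ h) - a) - 1ℚ) (OddTotals.#admissible-odd (¬char2 2<p) X q≡2X+1 m))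
                (subtract-sum (ℕ→ℚ (q ^ (k ∸ h))) (ℕ→ℚ (q ^ h)) (Γ h q) (ℕ→ℚ h * Γ (suc m) q))))
  where
  open FieldCounting F
  h : ℕ
  h = suc (suc m)
  2≤h : 2 ≤ h
  2≤h = s≤s (s≤s z≤n)
  char2 : p ≡ 2 → Char2
  char2 p≡2 = char2-of-2-power n (subst (λ p → q ≡ p ^ n) p≡2 q≡pⁿ)
  ¬char2 : 2 < p → ¬ Char2
  ¬char2 2<p = ¬char2-of-odd-prime-power n p-prime 2<p q≡pⁿ
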